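{- Let $\ell\ge2$ and let $\mathcal{M}a\mathcal{R}$ be the group of multiple almost-Riordan arrays. Then: (a) the set $\mathcal A$ of all normalized arrays of the form $(b|g;t,t,\dots,t)$ is a subgroup of $\mathcal{M}a\mathcal{R}$ (the Appell subgroup); (b) the set $\mathcal L$ of all arrays of the form $(1|1;f_1,f_2,\dots,f_\ell)$ is a subgroup of $\mathcal{M}a\mathcal{R}$ (the Lagrange subgroup); (c) for each $j=1,2,\dots,\ell$, the set $\mathcal B_j$ of all normalized arrays $(b|g;f_1,\dots,f_\ell)$ with $f_j=tg$ is a subgroup of $\mathcal{M}a\mathcal{R}$ (the type-$j$ Bell subgroup).
   Context: Fix an integer $\ell\ge2$ and a field $\mathbb K$ of characteristic $0$ (e.g. $\mathbb C$); $\mathbb K[[t^\ell]]$ denotes the formal power series in $t^\ell$. For $b,g\in\mathbb K[[t^\ell]]$ with $b(0)\ne0$, $g(0)\ne0$ and $f_1,\dots,f_\ell\in t\mathbb K[[t^\ell]]$ with nonzero coefficient of $t$, the multiple almost-Riordan array $(b|g;f_1,\dots,f_\ell)$ is the infinite lower triangular matrix $(d_{n,k})_{n,k\ge0}$ with $d_{n,0}=[t^n]b(t)$ and, for $k\ge1$, $d_{n,k}=[t^n]\,t\,g\,f_1^{e_1(k)}\cdots f_\ell^{e_\ell(k)}$ with $e_i(k)=\lfloor (k-1+\ell-i)/\ell\rfloor$ (columns $b, tg, tgf_1, tgf_1f_2,\dots,tgf_1\cdots f_\ell, tgf_1^2f_2\cdots f_\ell,\dots$). The set $\mathcal{M}a\mathcal{R}$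 of all such arrays is a group under ordinary matrix multiplication. An array $(b|g;f_1,\dots,f_\ell)$ is called normalized if $b(0)=g(0)=1$. -}

module Defs where

open import Level using (_⊔_)
open import Algebra.Bundles using (CommutativeRing)
open import Data.Nat using (ℕ; zero; suc; _∸_; _/_) renaming (_+_ to _+ℕ_)
open import Data.Nat.Divisibility using (_∣_)
open import Data.Fin using (Fin; toℕ) renaming (zero to fzero; suc to fsuc)
open import Data.Product using (Σ; _×_; _,_)
open import Relation.Nullary using (¬_)

record IsField {c l} (R : CommutativeRing c l) : Set (c ⊔ l) where
  open CommutativeRing R
  field
    0≉1 : ¬ (0# ≈ 1#)
    inverse : ∀ x → ¬ (x ≈ 0#) → Σ Carrier (λ y → x * y ≈ 1#)

module _ {c l} (R : CommutativeRing c l) where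
  open CommutativeRing R

  natR : ℕ → Carrier
  natR zero = 0#
  natR (suc n) = 1# + natR n

  CharZero : Set l
  CharZero = ∀ n → ¬ (natR (suc n) ≈ 0#)

-- floor division, with the harmless convention a / 0 = 0 (only used for ℓ ≥ 2)
fdiv : ℕ → ℕ → ℕ
fdiv a zero = 0
fdiv a (suc m) = a / suc m

module MaR {c l} (R : CommutativeRing c l) (ℓ : ℕ) where
  open CommutativeRing R

  Series : Set c
  Series = ℕ → Carrier

  -- infinite matrices (entry at row n, column k)
  Matrix : Set c
  Matrix = ℕ → ℕ → Carrier

  _≋_ : Matrix → Matrix → Set l
  M ≋ N = ∀ n k → M n k ≈ N n k

  sumTo : (ℕ → Carrier) → ℕ → Carrier
  sumTo a zero = a 0
  sumTo a (suc n) = sumTo a n + a (suc n)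

  oneS : Series
  oneS zero = 1#
  oneS (suc _) = 0#

  tS : Series
  tS zero = 0#
  tS (suc zero) = 1#
  tS (suc (suc _)) = 0#

  shift : Series → Series
  shift a zero = 0#
  shift a (suc n) = a n

  _⋆_ : Series → Series → Series
  (a ⋆ b) n = sumTo (λ i → a i * b (n ∸ i)) n

  _^S_ : Series → ℕ → Series
  a ^S zero = oneS
  a ^S suc e = a ⋆ (a ^S e)

  prodFin : (m : ℕ) → (Fin m → Series) → Series
  prodFin zero f = oneS
  prodFin (suc m) f = f fzero ⋆ prodFin m (λ i → f (fsuc i))

  InTl : Series → Set l
  InTl a = ∀ n → ¬ (ℓ ∣ n) → a n ≈ 0#

  ValidF : Series → Set l
  ValidF f = f 0 ≈ 0# × (∀ n → ¬ (ℓ ∣ n) → f (suc n) ≈ 0#) × ¬ (f 1 ≈ 0#)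

  -- exponent e_i(k) = ⌊(k-1+ℓ-i)/ℓ⌋ for k ≥ 1, where the Fin index j
  -- stands for i = j+1; the argument k' stands for k = k'+1
  expo : Fin ℓ → ℕ → ℕ
  expo j k' = fdiv (k' +ℕ (ℓ ∸ suc (toℕ j))) ℓ

  -- the multiple almost-Riordan array (b | g ; f_1, ..., f_ℓ), f i = f_{i+1}
  array : Series → Series → (Fin ℓ → Series) → Matrix
  array b g f n zero = b n
  array b g f n (suc k') = shift (g ⋆ prodFin ℓ (λ j → f j ^S expo j k')) n

  -- matrix product (rows of lower triangular matrices: Σ_{j=0}^{n})
  _⊗_ : Matrix → Matrix → Matrix
  (M ⊗ N) n k = sumTo (λ j → M n j * N j k) n

  idM : Matrix
  idM zero zero = 1#
  idM zero (suc _) = 0#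
  idM (suc _) zero = 0#
  idM (suc n) (suc k) = idM n k

  IsMaR : Matrix → Set (c ⊔ l)
  IsMaR M = Σ Series λ b → Σ Series λ g → Σ (Fin ℓ → Series) λ f →
    InTl b × InTl g × ¬ (b 0 ≈ 0#) × ¬ (g 0 ≈ 0#) × (∀ i → ValidF (f i))
    × M ≋ array b g f

  IsSubgroup : (Matrix → Set (c ⊔ l)) → Set (c ⊔ l)
  IsSubgroup S =
    (∀ M → S M → IsMaR M)
    × S idM
    × (∀ M N → S M → S N → S (M ⊗ N))
    × (∀ M → S M → Σ Matrix λ N → S N × (M ⊗ N) ≋ idM × (N ⊗ M) ≋ idM)

  Appell : Matrix → Set (c ⊔ l)
  Appell M = Σ Series λ b → Σ Series λ g →
    InTl b × InTl g × b 0 ≈ 1# × g 0 ≈ 1# × M ≋ array b g (λ _ → tS)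

  Lagrange : Matrix → Set (c ⊔ l)
  Lagrange M = Σ (Fin ℓ → Series) λ f →
    (∀ i → ValidF (f i)) × M ≋ array oneS oneS f

  -- type-j Bell (Fin index j stands for j+1): normalized, f_j = t g
  Bell : Fin ℓ → Matrix → Set (c ⊔ l)
  Bell j M = Σ Series λ b → Σ Series λ g → Σ (Fin ℓ → Series) λ f →
    InTl b × InTl g × b 0 ≈ 1# × g 0 ≈ 1# × (∀ i → ValidF (f i))
    × (∀ n → f j n ≈ shift g n) × M ≋ array b g f

module Submission where

-- Write g = γ(t^ℓ) and fⱼ = t φⱼ(t^ℓ). Because Σⱼ eⱼ(k) = k - 1, column k ≥ 1 of A = (b | g ; f) is
-- t^k (γ Φₖ)(t^ℓ) with Φₖ = ∏ⱼ φⱼ^eⱼ(k); because eⱼ(k + ℓ) = eⱼ(k) + 1, column k + mℓ is column k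
-- times P^m, where P = f₁ ⋯ f_ℓ = Q(t^ℓ). Hence A maps t^k w(t^ℓ) to (column k) · w(P), and applying
-- this to the columns of a second array gives the product rule
--   (b | g ; f) (b′ | g′ ; f′) = (A b′ | g γ′(P) ; fⱼ φ′ⱼ(P)).
-- Over a field, forward substitution solves A b′ = e₀, γ η(Q) = 1 and φⱼ θⱼ(Q) = 1, which yields the
-- right inverse (b′ | η(t^ℓ) ; t θⱼ(t^ℓ)); as ⊗ is associative on lower triangular matrices, a right
-- inverse that has a right inverse itself is two-sided.
-- Each class is closed under the product rule and contains these inverses: for Appell φⱼ = 1, so
-- θⱼ = 1 works; for Lagrange γ = 1 and b = 1; for type-j Bell φⱼ = γ, so θⱼ can serve as η.

open import Algebra.Bundles using (CommutativeRing; CommutativeMonoid)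
import Algebra.Properties.CommutativeSemigroup as CommutativeSemigroupProperties
import Algebra.Properties.Group as GroupProperties
open import Data.Fin using (Fin; toℕ) renaming (zero to fzero; suc to fsuc)
open import Data.Fin.Properties using (toℕ<n)
open import Data.Nat using (ℕ; zero; suc; _≤_; _<_; z≤n; s≤s; _∸_; _<?_; _%_; _/_)
  renaming (_+_ to _+ℕ_; _*_ to _*ℕ_)
open import Data.Nat.DivMod
  using (m≡m%n+[m/n]*n; m%n<n; m*n%n≡0; m*n/n≡m; n/n≡1; m<n⇒m/n≡0; /-congˡ; +-distrib-/-∣ʳ)
open import Data.Nat.Divisibility
  using (_∣_; _∤_; _∣?_; divides-refl; _∣0; ∣-refl; m%n≡0⇒n∣m; >⇒∤; ∣m+n∣m⇒∣n; ∣m∸n∣n⇒∣m; n∣m*n)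
open import Data.Nat.Induction using (<-rec)
import Data.Nat.Properties as ℕ
open import Algebra.Properties.CommutativeMonoid.Sum ℕ.+-0-commutativeMonoid
  using (sum; sum-cong-≗; sum-replicate-zero)
open import Data.Product using (Σ; _×_; _,_; proj₁; proj₂)
open import Data.Sum using (inj₁; inj₂)
open import Function using (_∘_)
open import Relation.Binary.Bundles using (Setoid)
open import Relation.Binary.PropositionalEquality as ≡ using (_≡_; _≢_)
open import Relation.Nullary using (yes; no; contradiction)
import Relation.Binary.Reasoning.Setoid as SetoidReasoning
open import Level using (_⊔_)

open import Defs

-- Defs defines every operation inside the module MaR R ℓ.
module FormalPowerSeries {c l} (R : CommutativeRing c l) (ℓ : ℕ) where

  open CommutativeRing R hiding (zero)
  open MaR R ℓ
  open CommutativeSemigroupProperties +-commutativeSemigroup using () renaming (interchange to +-interchange)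
  open CommutativeSemigroupProperties *-commutativeSemigroup using (x∙yz≈y∙xz)

  module ≈-Reasoning = SetoidReasoning setoid

  sum-cong-≤ : ∀ {a b : ℕ → Carrier} n → (∀ i → i ≤ n → a i ≈ b i) → sumTo a n ≈ sumTo b n
  sum-cong-≤ zero    a≈b = a≈b 0 z≤n
  sum-cong-≤ (suc n) a≈b =
    +-cong (sum-cong-≤ n (λ i i≤n → a≈b i (ℕ.m≤n⇒m≤1+n i≤n))) (a≈b (suc n) ℕ.≤-refl)

  sum-cong : ∀ {a b : ℕ → Carrier} n → (∀ i → a i ≈ b i) → sumTo a n ≈ sumTo b n
  sum-cong n a≈b = sum-cong-≤ n (λ i _ → a≈b i)

  sum-zero : ∀ (a : ℕ → Carrier) n → (∀ i → i ≤ n → a i ≈ 0#) → sumTo a n ≈ 0#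
  sum-zero a n a≈0 = trans (sum-cong-≤ n a≈0) (zeros n)
    where
    zeros : ∀ n → sumTo (λ _ → 0#) n ≈ 0#
    zeros zero    = refl
    zeros (suc n) = trans (+-congʳ (zeros n)) (+-identityˡ 0#)

  sum-distrib-+ : ∀ (a b : ℕ → Carrier) n → sumTo (λ i → a i + b i) n ≈ sumTo a n + sumTo b n
  sum-distrib-+ a b zero    = refl
  sum-distrib-+ a b (suc n) = trans (+-congʳ (sum-distrib-+ a b n)) (+-interchange _ _ _ _)

  *-distribˡ-sum : ∀ x (a : ℕ → Carrier) n → x * sumTo a n ≈ sumTo (λ i → x * a i) n
  *-distribˡ-sum x a zero    = refl
  *-distribˡ-sum x a (suc n) = trans (distribˡ x _ _) (+-congʳ (*-distribˡ-sum x a n))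

  *-distribʳ-sum : ∀ x (a : ℕ → Carrier) n → sumTo a n * x ≈ sumTo (λ i → a i * x) n
  *-distribʳ-sum x a zero    = refl
  *-distribʳ-sum x a (suc n) = trans (distribʳ x _ _) (+-congʳ (*-distribʳ-sum x a n))

  sum-head : ∀ (a : ℕ → Carrier) n → sumTo a (suc n) ≈ a 0 + sumTo (a ∘ suc) n
  sum-head a zero    = refl
  sum-head a (suc n) = trans (+-congʳ (sum-head a n)) (+-assoc _ _ _)

  sum-comm : ∀ (a : ℕ → ℕ → Carrier) n m →
    sumTo (λ i → sumTo (a i) m) n ≈ sumTo (λ j → sumTo (λ i → a i j) n) m
  sum-comm a zero    m = refl
  sum-comm a (suc n) m = trans (+-congʳ (sum-comm a n m))
    (sym (sum-distrib-+ (λ j → sumTo (λ i → a i j) n) (a (suc n)) m))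

  sum-extend : ∀ (a : ℕ → Carrier) {n} N → n ≤ N → (∀ i → n < i → i ≤ N → a i ≈ 0#) →
    sumTo a N ≈ sumTo a n
  sum-extend a zero    z≤n  _   = refl
  sum-extend a (suc N) n≤1+N a≈0 with ℕ.m≤n⇒m<n∨m≡n n≤1+N
  ... | inj₂ ≡.refl    = refl
  ... | inj₁ (s≤s n≤N) = trans
    (+-cong (sum-extend a N n≤N (λ i n<i i≤N → a≈0 i n<i (ℕ.m≤n⇒m≤1+n i≤N)))
            (a≈0 (suc N) (s≤s n≤N) ℕ.≤-refl))
    (+-identityʳ _)

  sum-single : ∀ (a : ℕ → Carrier) n {k} → k ≤ n → (∀ i → i ≤ n → i ≢ k → a i ≈ 0#) →
    sumTo a n ≈ a k
  sum-single a n {zero}  _   a≈0 = sum-extend a n z≤n (λ i 0<i i≤n → a≈0 i i≤n (ℕ.>⇒≢ 0<i))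
  sum-single a n {suc k} k<n a≈0 = begin
    sumTo a n             ≈⟨ sum-extend a n k<n (λ i k<i i≤n → a≈0 i i≤n (ℕ.>⇒≢ k<i)) ⟩
    sumTo a k + a (suc k) ≈⟨ +-congʳ (sum-zero a k below) ⟩
    0# + a (suc k)        ≈⟨ +-identityˡ _ ⟩
    a (suc k)             ∎
    where
    open ≈-Reasoning
    below : ∀ i → i ≤ k → a i ≈ 0#
    below i i≤k = a≈0 i (ℕ.≤-trans i≤k (ℕ.<⇒≤ k<n)) (ℕ.<⇒≢ (s≤s i≤k))

  sum-oneS : ∀ (a : ℕ → Carrier) n → sumTo (λ i → oneS i * a i) n ≈ a 0
  sum-oneS a n = trans (sum-single _ n z≤n vanish) (*-identityˡ _)
    where
    vanish : ∀ i → i ≤ n → i ≢ 0 → oneS i * a i ≈ 0#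
    vanish zero    _ i≢0 = contradiction ≡.refl i≢0
    vanish (suc i) _ _   = zeroˡ _

  sum-reverse : ∀ (a : ℕ → Carrier) n → sumTo a n ≈ sumTo (λ i → a (n ∸ i)) n
  sum-reverse a zero    = refl
  sum-reverse a (suc n) = begin
    sumTo a n + a (suc n)                 ≈⟨ +-comm _ _ ⟩
    a (suc n) + sumTo a n                 ≈⟨ +-congˡ (sum-reverse a n) ⟩
    a (suc n) + sumTo (λ i → a (n ∸ i)) n ≈⟨ sum-head (λ i → a (suc n ∸ i)) n ⟨
    sumTo (λ i → a (suc n ∸ i)) (suc n)   ∎
    where open ≈-Reasoning

  sum-drop : ∀ (a : ℕ → Carrier) s N → (∀ i → i < s → a i ≈ 0#) →
    sumTo a (s +ℕ N) ≈ sumTo (λ k → a (s +ℕ k)) N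
  sum-drop a zero    N _   = refl
  sum-drop a (suc s) N a≈0 = begin
    sumTo a (suc s +ℕ N)                ≈⟨ sum-head a (s +ℕ N) ⟩
    a 0 + sumTo (a ∘ suc) (s +ℕ N)      ≈⟨ +-cong (a≈0 0 (s≤s z≤n)) (sum-drop (a ∘ suc) s N later≈0) ⟩
    0# + sumTo (λ k → a (suc s +ℕ k)) N ≈⟨ +-identityˡ _ ⟩
    sumTo (λ k → a (suc s +ℕ k)) N      ∎
    where
    open ≈-Reasoning
    later≈0 : ∀ i → i < s → a (suc i) ≈ 0#
    later≈0 i i<s = a≈0 (suc i) (s≤s i<s)

  sum-split : ∀ (a : ℕ → Carrier) N d →
    sumTo a (N +ℕ suc d) ≈ sumTo a N + sumTo (λ j → a (suc N +ℕ j)) d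
  sum-split a N zero    rewrite ℕ.+-comm N 1 | ℕ.+-identityʳ N = refl
  sum-split a N (suc d) = begin
    sumTo a (N +ℕ suc (suc d))                         ≡⟨ ≡.cong (sumTo a) (ℕ.+-suc N (suc d)) ⟩
    sumTo a (N +ℕ suc d) + a (suc (N +ℕ suc d))        ≈⟨ +-congʳ (sum-split a N d) ⟩
    (sumTo a N + Tail d) + a (suc N +ℕ suc d)          ≈⟨ +-assoc _ _ _ ⟩
    sumTo a N + Tail (suc d)                           ∎
    where
    open ≈-Reasoning
    Tail : ℕ → Carrier
    Tail = sumTo (λ j → a (suc N +ℕ j))

  sum-triangle : ∀ (X : ℕ → ℕ → Carrier) n →
    sumTo (λ i → sumTo (λ j → X j i) i) n ≈ sumTo (λ j → sumTo (λ k → X j (j +ℕ k)) (n ∸ j)) n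
  sum-triangle X zero    = refl
  sum-triangle X (suc n) = begin
    sumTo (λ i → sumTo (λ j → X j i) i) n + (sumTo (λ j → X j (suc n)) n + X (suc n) (suc n))
      ≈⟨ +-congʳ (sum-triangle X n) ⟩
    sumTo (λ j → Row j n) n + (sumTo (λ j → X j (suc n)) n + X (suc n) (suc n))
      ≈⟨ +-assoc _ _ _ ⟨
    (sumTo (λ j → Row j n) n + sumTo (λ j → X j (suc n)) n) + X (suc n) (suc n)
      ≈⟨ +-cong (sum-distrib-+ _ _ n) (reflexive (≡.cong (X (suc n)) (ℕ.+-identityʳ (suc n)))) ⟨
    sumTo (λ j → Row j n + X j (suc n)) n + X (suc n) (suc n +ℕ 0)
      ≈⟨ +-cong (sum-cong-≤ n extendRow) (reflexive (≡.cong (sumTo (λ k → X (suc n) (suc n +ℕ k))) (ℕ.n∸n≡0 n))) ⟨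
    sumTo (λ j → Row j (suc n)) n + Row (suc n) (suc n) ∎
    where
    open ≈-Reasoning
    Row : ℕ → ℕ → Carrier
    Row j n = sumTo (λ k → X j (j +ℕ k)) (n ∸ j)
    extendRow : ∀ j → j ≤ n → Row j (suc n) ≈ Row j n + X j (suc n)
    extendRow j j≤n rewrite ℕ.+-∸-assoc 1 j≤n =
      +-congˡ (reflexive (≡.cong (X j) (≡.trans (ℕ.+-suc j (n ∸ j)) (≡.cong suc (ℕ.m+[n∸m]≡n j≤n)))))

  infix 4 _≈ₛ_
  _≈ₛ_ : Series → Series → Set l
  a ≈ₛ b = ∀ n → a n ≈ b n

  ≈ₛ-setoid : Setoid c l
  ≈ₛ-setoid = record
    { Carrier       = Series
    ; _≈_           = _≈ₛ_
    ; isEquivalence = record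
      { refl  = λ _ → refl
      ; sym   = λ a≈b n → sym (a≈b n)
      ; trans = λ a≈b b≈d n → trans (a≈b n) (b≈d n)
      }
    }

  open Setoid ≈ₛ-setoid public using ()
    renaming (refl to ≈ₛ-refl; sym to ≈ₛ-sym; trans to ≈ₛ-trans; isEquivalence to ≈ₛ-isEquivalence)
  module ≈ₛ-Reasoning = SetoidReasoning ≈ₛ-setoid

  ⋆-cong : ∀ {a a′ b b′} → a ≈ₛ a′ → b ≈ₛ b′ → a ⋆ b ≈ₛ a′ ⋆ b′
  ⋆-cong a≈a′ b≈b′ n = sum-cong n (λ i → *-cong (a≈a′ i) (b≈b′ (n ∸ i)))

  ⋆-congˡ : ∀ a {b b′} → b ≈ₛ b′ → a ⋆ b ≈ₛ a ⋆ b′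
  ⋆-congˡ a = ⋆-cong {a} ≈ₛ-refl

  ⋆-congʳ : ∀ b {a a′} → a ≈ₛ a′ → a ⋆ b ≈ₛ a′ ⋆ b
  ⋆-congʳ b a≈a′ = ⋆-cong {b = b} a≈a′ ≈ₛ-refl

  ⋆-comm : ∀ a b → a ⋆ b ≈ₛ b ⋆ a
  ⋆-comm a b n = trans (sum-reverse _ n)
    (sum-cong-≤ n (λ i i≤n → trans (*-comm _ _) (*-congʳ (reflexive (≡.cong b (ℕ.m∸[m∸n]≡n i≤n))))))

  ⋆-assoc : ∀ a b d → (a ⋆ b) ⋆ d ≈ₛ a ⋆ (b ⋆ d)
  ⋆-assoc a b d n = begin
    sumTo (λ i → sumTo (λ j → a j * b (i ∸ j)) i * d (n ∸ i)) n
      ≈⟨ sum-cong n (λ i → *-distribʳ-sum _ _ i) ⟩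
    sumTo (λ i → sumTo (λ j → (a j * b (i ∸ j)) * d (n ∸ i)) i) n
      ≈⟨ sum-triangle (λ j i → (a j * b (i ∸ j)) * d (n ∸ i)) n ⟩
    sumTo (λ j → sumTo (λ k → (a j * b ((j +ℕ k) ∸ j)) * d (n ∸ (j +ℕ k))) (n ∸ j)) n
      ≈⟨ sum-cong n (λ j → sum-cong (n ∸ j) (λ k → trans (*-assoc _ _ _) (*-congˡ (*-cong
           (reflexive (≡.cong b (ℕ.m+n∸m≡n j k))) (reflexive (≡.cong d (≡.sym (ℕ.∸-+-assoc n j k)))))))) ⟩
    sumTo (λ j → sumTo (λ k → a j * (b k * d ((n ∸ j) ∸ k))) (n ∸ j)) n
      ≈⟨ sum-cong n (λ j → *-distribˡ-sum _ _ (n ∸ j)) ⟨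
    sumTo (λ j → a j * sumTo (λ k → b k * d ((n ∸ j) ∸ k)) (n ∸ j)) n ∎
    where open ≈-Reasoning

  ⋆-identityˡ : ∀ a → oneS ⋆ a ≈ₛ a
  ⋆-identityˡ a n = sum-oneS (λ i → a (n ∸ i)) n

  ⋆-identityʳ : ∀ a → a ⋆ oneS ≈ₛ a
  ⋆-identityʳ a = ≈ₛ-trans (⋆-comm a oneS) (⋆-identityˡ a)

  ⋆-commutativeMonoid : CommutativeMonoid c l
  ⋆-commutativeMonoid = record
    { Carrier             = Series
    ; _≈_                 = _≈ₛ_
    ; _∙_                 = _⋆_
    ; ε                   = oneS
    ; isCommutativeMonoid = record
      { isMonoid = record
        { isSemigroup = record
          { isMagma = record { isEquivalence = ≈ₛ-isEquivalence ; ∙-cong = ⋆-cong }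
          ; assoc   = ⋆-assoc
          }
        ; identity    = ⋆-identityˡ , ⋆-identityʳ
        }
      ; comm     = ⋆-comm
      }
    }

  open CommutativeSemigroupProperties (CommutativeMonoid.commutativeSemigroup ⋆-commutativeMonoid)
    public using () renaming (interchange to ⋆-interchange)

  infixr 7 _·ₛ_
  _·ₛ_ : Carrier → Series → Series
  (x ·ₛ a) n = x * a n

  ·ₛ-congˡ : ∀ {x a b} → a ≈ₛ b → x ·ₛ a ≈ₛ x ·ₛ b
  ·ₛ-congˡ a≈b n = *-congˡ (a≈b n)

  ⋆-·ₛ-comm : ∀ x a b → a ⋆ (x ·ₛ b) ≈ₛ x ·ₛ (a ⋆ b)
  ⋆-·ₛ-comm x a b n = trans (sum-cong n (λ i → x∙yz≈y∙xz (a i) x (b (n ∸ i)))) (sym (*-distribˡ-sum x _ n))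

  shift-cong : ∀ {a b} → a ≈ₛ b → shift a ≈ₛ shift b
  shift-cong a≈b zero    = refl
  shift-cong a≈b (suc n) = a≈b n

  shift-oneS : shift oneS ≈ₛ tS
  shift-oneS zero          = refl
  shift-oneS (suc zero)    = refl
  shift-oneS (suc (suc n)) = refl

  shift≈t⋆ : ∀ a → shift a ≈ₛ tS ⋆ a
  shift≈t⋆ a zero    = sym (zeroˡ _)
  shift≈t⋆ a (suc n) = sym (trans (sum-single _ (suc n) (s≤s z≤n) tS-vanishes) (*-identityˡ _))
    where
    tS-vanishes : ∀ i → i ≤ suc n → i ≢ 1 → tS i * a (suc n ∸ i) ≈ 0#
    tS-vanishes zero          _ _   = zeroˡ _
    tS-vanishes (suc zero)    _ i≢1 = contradiction ≡.refl i≢1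
    tS-vanishes (suc (suc i)) _ _   = zeroˡ _

  shift-⋆ : ∀ a b → shift a ⋆ b ≈ₛ shift (a ⋆ b)
  shift-⋆ a b = begin
    shift a ⋆ b   ≈⟨ ⋆-congʳ b (shift≈t⋆ a) ⟩
    (tS ⋆ a) ⋆ b  ≈⟨ ⋆-assoc tS a b ⟩
    tS ⋆ (a ⋆ b)  ≈⟨ shift≈t⋆ (a ⋆ b) ⟨
    shift (a ⋆ b) ∎
    where open ≈ₛ-Reasoning

  ^S-cong : ∀ {a b} n → a ≈ₛ b → a ^S n ≈ₛ b ^S n
  ^S-cong zero    a≈b = ≈ₛ-refl
  ^S-cong (suc n) a≈b = ⋆-cong a≈b (^S-cong n a≈b)

  ^S-homo-+ : ∀ a m n → a ^S (m +ℕ n) ≈ₛ (a ^S m) ⋆ (a ^S n)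
  ^S-homo-+ a zero    n = ≈ₛ-sym (⋆-identityˡ _)
  ^S-homo-+ a (suc m) n = ≈ₛ-trans (⋆-congˡ a (^S-homo-+ a m n)) (≈ₛ-sym (⋆-assoc a (a ^S m) (a ^S n)))

  ^S-distrib-⋆ : ∀ a b n → (a ⋆ b) ^S n ≈ₛ (a ^S n) ⋆ (b ^S n)
  ^S-distrib-⋆ a b zero    = ≈ₛ-sym (⋆-identityˡ oneS)
  ^S-distrib-⋆ a b (suc n) =
    ≈ₛ-trans (⋆-congˡ (a ⋆ b) (^S-distrib-⋆ a b n)) (⋆-interchange a b (a ^S n) (b ^S n))

  prodFin-cong : ∀ m {f g : Fin m → Series} → (∀ j → f j ≈ₛ g j) → prodFin m f ≈ₛ prodFin m g
  prodFin-cong zero    f≈g = ≈ₛ-refl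
  prodFin-cong (suc m) f≈g = ⋆-cong (f≈g fzero) (prodFin-cong m (f≈g ∘ fsuc))

  prodFin-distrib-⋆ : ∀ m (f g : Fin m → Series) → prodFin m (λ j → f j ⋆ g j) ≈ₛ prodFin m f ⋆ prodFin m g
  prodFin-distrib-⋆ zero    f g = ≈ₛ-sym (⋆-identityˡ oneS)
  prodFin-distrib-⋆ (suc m) f g =
    ≈ₛ-trans (⋆-congˡ (f fzero ⋆ g fzero) (prodFin-distrib-⋆ m (f ∘ fsuc) (g ∘ fsuc)))
    (⋆-interchange (f fzero) (g fzero) (prodFin m (f ∘ fsuc)) (prodFin m (g ∘ fsuc)))

  prodFin-^S : ∀ m (f : Fin m → Series) k → prodFin m (λ j → f j ^S k) ≈ₛ prodFin m f ^S k
  prodFin-^S zero    f zero    = ≈ₛ-refl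
  prodFin-^S zero    f (suc k) = ≈ₛ-trans (prodFin-^S zero f k) (≈ₛ-sym (⋆-identityˡ _))
  prodFin-^S (suc m) f k       = ≈ₛ-trans (⋆-congˡ (f fzero ^S k) (prodFin-^S m (f ∘ fsuc) k))
    (≈ₛ-sym (^S-distrib-⋆ (f fzero) (prodFin m (f ∘ fsuc)) k))

  prodFin-const : ∀ m a → prodFin m (λ _ → a) ≈ₛ a ^S m
  prodFin-const zero    a = ≈ₛ-refl
  prodFin-const (suc m) a = ⋆-congˡ a (prodFin-const m a)

  prodFin-^S-sum : ∀ m a (e : Fin m → ℕ) → prodFin m (λ j → a ^S e j) ≈ₛ a ^S sum e
  prodFin-^S-sum zero    a e = ≈ₛ-refl
  prodFin-^S-sum (suc m) a e = ≈ₛ-trans (⋆-congˡ (a ^S e fzero) (prodFin-^S-sum m a (e ∘ fsuc)))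
    (≈ₛ-sym (^S-homo-+ a (e fzero) (sum (e ∘ fsuc))))

  prodFin-^S-+ : ∀ m (f : Fin m → Series) (e : Fin m → ℕ) k →
    prodFin m (λ j → f j ^S (e j +ℕ k)) ≈ₛ prodFin m (λ j → f j ^S e j) ⋆ (prodFin m f ^S k)
  prodFin-^S-+ m f e k = ≈ₛ-trans (prodFin-cong m (λ j → ^S-homo-+ (f j) (e j) k))
    (≈ₛ-trans (prodFin-distrib-⋆ m _ _) (⋆-congˡ (prodFin m (λ j → f j ^S e j)) (prodFin-^S m f k)))

  module ⋆-Homomorphism (h : Series → Series) (h-one : h oneS ≈ₛ oneS)
                        (h-⋆ : ∀ a b → h (a ⋆ b) ≈ₛ h a ⋆ h b) where

    h-^S : ∀ a n → h (a ^S n) ≈ₛ h a ^S n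
    h-^S a zero    = h-one
    h-^S a (suc n) = ≈ₛ-trans (h-⋆ a _) (⋆-congˡ (h a) (h-^S a n))

    h-prodFin : ∀ m (f : Fin m → Series) → h (prodFin m f) ≈ₛ prodFin m (h ∘ f)
    h-prodFin zero    f = h-one
    h-prodFin (suc m) f = ≈ₛ-trans (h-⋆ _ _) (⋆-congˡ (h (f fzero)) (h-prodFin m (f ∘ fsuc)))

    h-prodFin-^S : ∀ m (f : Fin m → Series) (e : Fin m → ℕ) →
      h (prodFin m (λ j → f j ^S e j)) ≈ₛ prodFin m (λ j → h (f j) ^S e j)
    h-prodFin-^S m f e = ≈ₛ-trans (h-prodFin m _) (prodFin-cong m (λ j → h-^S (f j) (e j)))

  infix 4 t^_∣_
  t^_∣_ : ℕ → Series → Set l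
  t^ p ∣ a = ∀ i → i < p → a i ≈ 0#

  t^∣-⋆ : ∀ {a b} p q → t^ p ∣ a → t^ q ∣ b → t^ (p +ℕ q) ∣ a ⋆ b
  t^∣-⋆ {a} {b} p q p∣a q∣b i i<p+q = sum-zero _ i vanishes
    where
    vanishes : ∀ j → j ≤ i → a j * b (i ∸ j) ≈ 0#
    vanishes j j≤i with j <? p
    ... | yes j<p = trans (*-congʳ (p∣a j j<p)) (zeroˡ _)
    ... | no  j≮p = trans (*-congˡ (q∣b (i ∸ j) i∸j<q)) (zeroʳ _)
      where
      i∸j<q : i ∸ j < q
      i∸j<q = ℕ.+-cancelˡ-< j (i ∸ j) q (≡.subst (_< j +ℕ q) (≡.sym (ℕ.m+[n∸m]≡n j≤i))
                (ℕ.<-≤-trans i<p+q (ℕ.+-monoˡ-≤ q (ℕ.≮⇒≥ j≮p))))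

  t^m∣^S : ∀ {P} → P 0 ≈ 0# → ∀ m → t^ m ∣ P ^S m
  t^m∣^S P₀≈0 zero    i ()
  t^m∣^S P₀≈0 (suc m) = t^∣-⋆ 1 m t∣P (t^m∣^S P₀≈0 m)
    where
    t∣P : t^ 1 ∣ _
    t∣P zero    _ = P₀≈0
    t∣P (suc i) (s≤s ())

  shiftBy : ℕ → Series → Series
  shiftBy zero    a = a
  shiftBy (suc k) a = shift (shiftBy k a)

  shiftBy-cong : ∀ k {a b} → a ≈ₛ b → shiftBy k a ≈ₛ shiftBy k b
  shiftBy-cong zero    a≈b = a≈b
  shiftBy-cong (suc k) a≈b = shift-cong (shiftBy-cong k a≈b)

  shiftBy-+ : ∀ k a i → shiftBy k a (k +ℕ i) ≡ a i
  shiftBy-+ zero    a i = ≡.refl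
  shiftBy-+ (suc k) a i = shiftBy-+ k a i

  shiftBy-below : ∀ k a i → i < k → shiftBy k a i ≡ 0#
  shiftBy-below (suc k) a zero    _         = ≡.refl
  shiftBy-below (suc k) a (suc i) (s≤s i<k) = shiftBy-below k a i i<k

  shiftBy-≥ : ∀ k a {i} → k ≤ i → shiftBy k a i ≡ a (i ∸ k)
  shiftBy-≥ k a k≤i = ≡.trans (≡.cong (shiftBy k a) (≡.sym (ℕ.m+[n∸m]≡n k≤i))) (shiftBy-+ k a _)

  shiftBy-diagonal : ∀ k a → shiftBy k a k ≡ a 0
  shiftBy-diagonal zero    a = ≡.refl
  shiftBy-diagonal (suc k) a = shiftBy-diagonal k a

  t^⋆≈shiftBy : ∀ k a → (tS ^S k) ⋆ a ≈ₛ shiftBy k a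
  t^⋆≈shiftBy zero    a = ⋆-identityˡ a
  t^⋆≈shiftBy (suc k) a = ≈ₛ-trans (⋆-assoc tS (tS ^S k) a)
    (≈ₛ-trans (≈ₛ-sym (shift≈t⋆ ((tS ^S k) ⋆ a))) (shift-cong (t^⋆≈shiftBy k a)))

  shiftBy-⋆ : ∀ k a b → shiftBy k a ⋆ b ≈ₛ shiftBy k (a ⋆ b)
  shiftBy-⋆ zero    a b = ≈ₛ-refl
  shiftBy-⋆ (suc k) a b = ≈ₛ-trans (shift-⋆ (shiftBy k a) b) (shift-cong (shiftBy-⋆ k a b))

  shift-^S : ∀ a m → shift a ^S m ≈ₛ shiftBy m (a ^S m)
  shift-^S a m = ≈ₛ-trans (^S-cong m (shift≈t⋆ a)) (≈ₛ-trans (^S-distrib-⋆ tS a m) (t^⋆≈shiftBy m (a ^S m)))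

  Summable : (ℕ → Series) → Set l
  Summable F = ∀ m → t^ m ∣ F m

  -- For summable F, coefficient n of Σₘ F m only involves m ≤ n.
  Σ∞ : (ℕ → Series) → Series
  Σ∞ F n = sumTo (λ m → F m n) n

  Σ∞-truncate : ∀ F → Summable F → ∀ n {N} → n ≤ N → sumTo (λ m → F m n) N ≈ Σ∞ F n
  Σ∞-truncate F summable n {N} n≤N = sum-extend _ N n≤N (λ m n<m _ → summable m n n<m)

  Σ∞-cong : ∀ {F G} → (∀ m → F m ≈ₛ G m) → Σ∞ F ≈ₛ Σ∞ G
  Σ∞-cong F≈G n = sum-cong n (λ m → F≈G m n)

  ⋆-Σ∞ : ∀ a F → Summable F → a ⋆ Σ∞ F ≈ₛ Σ∞ (λ m → a ⋆ F m)
  ⋆-Σ∞ a F summable n = begin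
    sumTo (λ i → a i * sumTo (λ m → F m (n ∸ i)) (n ∸ i)) n
      ≈⟨ sum-cong n (λ i → *-congˡ (Σ∞-truncate F summable (n ∸ i) (ℕ.m∸n≤m n i))) ⟨
    sumTo (λ i → a i * sumTo (λ m → F m (n ∸ i)) n) n
      ≈⟨ sum-cong n (λ i → *-distribˡ-sum _ _ n) ⟩
    sumTo (λ i → sumTo (λ m → a i * F m (n ∸ i)) n) n
      ≈⟨ sum-comm _ n n ⟩
    sumTo (λ m → sumTo (λ i → a i * F m (n ∸ i)) n) n ∎
    where open ≈-Reasoning

  -- w ∘ₛ P is the substitution w(P) = Σₘ wₘ Pᵐ, meaningful when P 0 ≈ 0#.
  _∘ₛ_ : Series → Series → Series
  w ∘ₛ P = Σ∞ (λ m → w m ·ₛ P ^S m)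

  ∘ₛ-summable : ∀ (w : Series) {P} → P 0 ≈ 0# → Summable (λ m → w m ·ₛ P ^S m)
  ∘ₛ-summable w {P} P₀≈0 m n n<m = trans (*-congˡ (t^m∣^S {P} P₀≈0 m n n<m)) (zeroʳ _)

  ∘ₛ-cong : ∀ {w w′ P P′} → w ≈ₛ w′ → P ≈ₛ P′ → w ∘ₛ P ≈ₛ w′ ∘ₛ P′
  ∘ₛ-cong w≈w′ P≈P′ n = sum-cong n (λ m → *-cong (w≈w′ m) (^S-cong m P≈P′ n))

  oneS-∘ₛ : ∀ P → oneS ∘ₛ P ≈ₛ oneS
  oneS-∘ₛ P n = sum-oneS (λ m → (P ^S m) n) n

  ⋆-∘ₛ : ∀ u v {P} → P 0 ≈ 0# → (u ⋆ v) ∘ₛ P ≈ₛ (u ∘ₛ P) ⋆ (v ∘ₛ P)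
  ⋆-∘ₛ u v {P} P₀≈0 = ≈ₛ-sym (≈ₛ-trans expand regroup)
    where
    DoubleSum : Series
    DoubleSum = Σ∞ (λ m → v m ·ₛ Σ∞ (λ k → u k ·ₛ P ^S (m +ℕ k)))

    shifted : ∀ m → (u ∘ₛ P) ⋆ (v m ·ₛ P ^S m) ≈ₛ v m ·ₛ Σ∞ (λ k → u k ·ₛ P ^S (m +ℕ k))
    shifted m = begin
      (u ∘ₛ P) ⋆ (v m ·ₛ P ^S m)                 ≈⟨ ⋆-·ₛ-comm (v m) (u ∘ₛ P) (P ^S m) ⟩
      v m ·ₛ ((u ∘ₛ P) ⋆ (P ^S m))               ≈⟨ ·ₛ-congˡ (⋆-comm (u ∘ₛ P) (P ^S m)) ⟩
      v m ·ₛ ((P ^S m) ⋆ (u ∘ₛ P))               ≈⟨ ·ₛ-congˡ (⋆-Σ∞ (P ^S m) _ (∘ₛ-summable u P₀≈0)) ⟩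
      v m ·ₛ Σ∞ (λ k → (P ^S m) ⋆ (u k ·ₛ P ^S k)) ≈⟨ ·ₛ-congˡ (Σ∞-cong (λ k →
                                                      ≈ₛ-trans (⋆-·ₛ-comm (u k) (P ^S m) (P ^S k))
                                                               (·ₛ-congˡ (≈ₛ-sym (^S-homo-+ P m k))))) ⟩
      v m ·ₛ Σ∞ (λ k → u k ·ₛ P ^S (m +ℕ k))     ∎
      where open ≈ₛ-Reasoning

    expand : (u ∘ₛ P) ⋆ (v ∘ₛ P) ≈ₛ DoubleSum
    expand = ≈ₛ-trans (⋆-Σ∞ (u ∘ₛ P) _ (∘ₛ-summable v P₀≈0)) (Σ∞-cong shifted)

    regroup : DoubleSum ≈ₛ (u ⋆ v) ∘ₛ P
    regroup n = begin
      sumTo (λ m → v m * sumTo (λ k → u k * (P ^S (m +ℕ k)) n) n) n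
        ≈⟨ sum-cong n (λ m → *-distribˡ-sum _ _ n) ⟩
      sumTo (λ m → sumTo (λ k → v m * (u k * (P ^S (m +ℕ k)) n)) n) n
        ≈⟨ sum-comm _ n n ⟩
      sumTo (λ k → sumTo (λ m → v m * (u k * (P ^S (m +ℕ k)) n)) n) n
        ≈⟨ sum-cong n (λ k → sum-extend _ n (ℕ.m∸n≤m n k) (λ m n∸k<m _ → beyond k m n∸k<m)) ⟩
      sumTo (λ k → sumTo (λ m → v m * (u k * (P ^S (m +ℕ k)) n)) (n ∸ k)) n
        ≈⟨ sum-cong n (λ k → sum-cong (n ∸ k) (λ m → trans (sym (*-assoc _ _ _)) (*-cong
             (trans (*-comm _ _) (*-congˡ (reflexive (≡.cong v (≡.sym (ℕ.m+n∸m≡n k m))))))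
             (reflexive (≡.cong (λ e → (P ^S e) n) (ℕ.+-comm m k)))))) ⟩
      sumTo (λ k → sumTo (λ j → (u k * v ((k +ℕ j) ∸ k)) * (P ^S (k +ℕ j)) n) (n ∸ k)) n
        ≈⟨ sum-triangle (λ k s → (u k * v (s ∸ k)) * (P ^S s) n) n ⟨
      sumTo (λ s → sumTo (λ k → (u k * v (s ∸ k)) * (P ^S s) n) s) n
        ≈⟨ sum-cong n (λ s → *-distribʳ-sum _ _ s) ⟨
      sumTo (λ s → (u ⋆ v) s * (P ^S s) n) n ∎
      where
      open ≈-Reasoning
      beyond : ∀ k m → n ∸ k < m → v m * (u k * (P ^S (m +ℕ k)) n) ≈ 0#
      beyond k m n∸k<m =
        trans (*-congˡ (trans (*-congˡ (t^m∣^S {P} P₀≈0 (m +ℕ k) n n<m+k)) (zeroʳ _))) (zeroʳ _)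
        where
        n<m+k : n < m +ℕ k
        n<m+k = ℕ.≤-<-trans (ℕ.m≤n+m∸n n k)
          (≡.subst (k +ℕ (n ∸ k) <_) (ℕ.+-comm k m) (ℕ.+-monoʳ-< k n∸k<m))

  ∘ₛ-constantTerm : ∀ w P → (w ∘ₛ P) 0 ≈ w 0
  ∘ₛ-constantTerm w P = *-identityʳ (w 0)

  ⋆-∘ₛ-expand : ∀ X w {P} → P 0 ≈ 0# → ∀ {n N} → n ≤ N →
    (X ⋆ (w ∘ₛ P)) n ≈ sumTo (λ m → (X ⋆ (P ^S m)) n * w m) N
  ⋆-∘ₛ-expand X w {P} P₀≈0 {n} {N} n≤N = begin
    (X ⋆ (w ∘ₛ P)) n                        ≈⟨ ⋆-Σ∞ X _ (∘ₛ-summable w P₀≈0) n ⟩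
    sumTo (λ m → (X ⋆ (w m ·ₛ P ^S m)) n) n ≈⟨ sum-cong n (λ m → trans (⋆-·ₛ-comm (w m) X (P ^S m) n) (*-comm _ _)) ⟩
    sumTo (λ m → (X ⋆ (P ^S m)) n * w m) n  ≈⟨ sum-extend _ N n≤N (λ m n<m _ → beyond m n<m) ⟨
    sumTo (λ m → (X ⋆ (P ^S m)) n * w m) N  ∎
    where
    open ≈-Reasoning
    beyond : ∀ m → n < m → (X ⋆ (P ^S m)) n * w m ≈ 0#
    beyond m n<m = trans (*-congʳ (t^∣-⋆ 0 m (λ _ ()) (t^m∣^S {P} P₀≈0 m) n n<m)) (zeroˡ _)

  module ∘ₛ-Homomorphism {P} (P₀≈0 : P 0 ≈ 0#) =
    ⋆-Homomorphism (_∘ₛ P) (oneS-∘ₛ P) (λ u v → ⋆-∘ₛ u v P₀≈0)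

module InfiniteMatrices {c l} (R : CommutativeRing c l) (ℓ : ℕ) where

  open CommutativeRing R hiding (zero)
  open MaR R ℓ
  open FormalPowerSeries R ℓ

  column : Matrix → ℕ → Series
  column M k j = M j k

  infixr 7 _*ᵛ_
  _*ᵛ_ : Matrix → Series → Series
  (M *ᵛ x) n = sumTo (λ j → M n j * x j) n

  *ᵛ-congˡ : ∀ M {x y} → x ≈ₛ y → M *ᵛ x ≈ₛ M *ᵛ y
  *ᵛ-congˡ M x≈y n = sum-cong n (λ j → *-congˡ (x≈y j))

  *ᵛ-oneS : ∀ M → M *ᵛ oneS ≈ₛ column M 0
  *ᵛ-oneS M n = trans (sum-cong n (λ j → *-comm (M n j) (oneS j))) (sum-oneS (M n) n)

  ≋-refl : ∀ {M} → M ≋ M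
  ≋-refl n k = refl

  ≋-sym : ∀ {M N} → M ≋ N → N ≋ M
  ≋-sym M≋N n k = sym (M≋N n k)

  ≋-trans : ∀ {M N O} → M ≋ N → N ≋ O → M ≋ O
  ≋-trans M≋N N≋O n k = trans (M≋N n k) (N≋O n k)

  ⊗-cong : ∀ {M M′ N N′} → M ≋ M′ → N ≋ N′ → (M ⊗ N) ≋ (M′ ⊗ N′)
  ⊗-cong M≋M′ N≋N′ n k = sum-cong n (λ j → *-cong (M≋M′ n j) (N≋N′ j k))

  LowerTriangular : Matrix → Set l
  LowerTriangular M = ∀ {n k} → n < k → M n k ≈ 0#

  idM-diagonal : ∀ n → idM n n ≡ 1#
  idM-diagonal zero    = ≡.refl
  idM-diagonal (suc n) = idM-diagonal n

  idM-offDiagonal : ∀ {n k} → n ≢ k → idM n k ≡ 0#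
  idM-offDiagonal {zero}  {zero}  n≢k = contradiction ≡.refl n≢k
  idM-offDiagonal {zero}  {suc k} _   = ≡.refl
  idM-offDiagonal {suc n} {zero}  _   = ≡.refl
  idM-offDiagonal {suc n} {suc k} n≢k = idM-offDiagonal (n≢k ∘ ≡.cong suc)

  shiftBy-oneS≈idM : ∀ k n → shiftBy k oneS n ≈ idM n k
  shiftBy-oneS≈idM zero    zero    = refl
  shiftBy-oneS≈idM zero    (suc n) = refl
  shiftBy-oneS≈idM (suc k) zero    = refl
  shiftBy-oneS≈idM (suc k) (suc n) = shiftBy-oneS≈idM k n

  idM-⊗ : ∀ N → (idM ⊗ N) ≋ N
  idM-⊗ N n k = trans
    (sum-single _ n ℕ.≤-refl (λ j _ j≢n → trans (*-congʳ (reflexive (idM-offDiagonal (j≢n ∘ ≡.sym)))) (zeroˡ _)))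
    (trans (*-congʳ (reflexive (idM-diagonal n))) (*-identityˡ _))

  ⊗-idM : ∀ M → LowerTriangular M → (M ⊗ idM) ≋ M
  ⊗-idM M lower n k with k ℕ.≤? n
  ... | yes k≤n = trans
    (sum-single _ n k≤n (λ j _ j≢k → trans (*-congˡ (reflexive (idM-offDiagonal j≢k))) (zeroʳ _)))
    (trans (*-congˡ (reflexive (idM-diagonal k))) (*-identityʳ _))
  ... | no  k≰n = trans
    (sum-zero _ n (λ j j≤n → trans (*-congˡ (reflexive (idM-offDiagonal (j≢k j≤n)))) (zeroʳ _)))
    (sym (lower (ℕ.≰⇒> k≰n)))
    where
    j≢k : ∀ {j} → j ≤ n → j ≢ k
    j≢k j≤n ≡.refl = k≰n j≤n

  ⊗-assoc : ∀ M N O → LowerTriangular N → ((M ⊗ N) ⊗ O) ≋ (M ⊗ (N ⊗ O))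
  ⊗-assoc M N O lower n k = begin
    sumTo (λ j → sumTo (λ i → M n i * N i j) n * O j k) n
      ≈⟨ sum-cong n (λ j → *-distribʳ-sum _ _ n) ⟩
    sumTo (λ j → sumTo (λ i → (M n i * N i j) * O j k) n) n
      ≈⟨ sum-comm _ n n ⟩
    sumTo (λ i → sumTo (λ j → (M n i * N i j) * O j k) n) n
      ≈⟨ sum-cong n (λ i → trans (sum-cong n (λ j → *-assoc _ _ _)) (sym (*-distribˡ-sum _ _ n))) ⟩
    sumTo (λ i → M n i * sumTo (λ j → N i j * O j k) n) n
      ≈⟨ sum-cong-≤ n (λ i i≤n → *-congˡ (sum-extend _ n i≤n (λ j i<j _ → N-vanishes i<j))) ⟩
    sumTo (λ i → M n i * sumTo (λ j → N i j * O j k) i) n ∎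
    where
    open ≈-Reasoning
    N-vanishes : ∀ {i j} → i < j → N i j * O j k ≈ 0#
    N-vanishes i<j = trans (*-congʳ (lower i<j)) (zeroˡ _)

  -- M = M ⊗ (N ⊗ N′) = (M ⊗ N) ⊗ N′ = N′, so N ⊗ M = N ⊗ N′ = idM.
  rightInverse⇒leftInverse : ∀ M N N′ → LowerTriangular M → LowerTriangular N →
    (M ⊗ N) ≋ idM → (N ⊗ N′) ≋ idM → (N ⊗ M) ≋ idM
  rightInverse⇒leftInverse M N N′ lowerM lowerN MN≋I NN′≋I = ≋-trans (⊗-cong (≋-refl {N}) M≋N′) NN′≋I
    where
    M≋N′ : M ≋ N′
    M≋N′ = ≋-trans (≋-sym (⊗-idM M lowerM)) (≋-trans (⊗-cong (≋-refl {M}) (≋-sym NN′≋I))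
             (≋-trans (≋-sym (⊗-assoc M N N′ lowerN)) (≋-trans (⊗-cong MN≋I (≋-refl {N′})) (idM-⊗ N′))))

module Spreading {c l} (R : CommutativeRing c l) (ℓ₁ : ℕ) where

  ℓ : ℕ
  ℓ = suc ℓ₁

  open CommutativeRing R hiding (zero)
  open MaR R ℓ
  open FormalPowerSeries R ℓ

  whenZero : ℕ → Carrier → Carrier
  whenZero zero    x = x
  whenZero (suc _) _ = 0#

  -- spread w is the series w(t^ℓ).
  spread : Series → Series
  spread w n = whenZero (n % ℓ) (w (n / ℓ))

  decimate : Series → Series
  decimate a q = a (q *ℕ ℓ)

  data MultipleView : ℕ → Set where
    multiple    : ∀ q → MultipleView (q *ℕ ℓ)
    nonMultiple : ∀ {n} → ℓ ∤ n → MultipleView n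

  multipleView : ∀ n → MultipleView n
  multipleView n with ℓ ∣? n
  ... | yes (divides-refl q) = multiple q
  ... | no  ℓ∤n              = nonMultiple ℓ∤n

  spread-multiple : ∀ w q → spread w (q *ℕ ℓ) ≈ w q
  spread-multiple w q = reflexive (≡.cong₂ whenZero (m*n%n≡0 q ℓ) (≡.cong w (m*n/n≡m q ℓ)))

  spread-nonMultiple : ∀ w {n} → ℓ ∤ n → spread w n ≈ 0#
  spread-nonMultiple w {n} ℓ∤n = reflexive (whenZero-nonZero (n % ℓ) (ℓ∤n ∘ m%n≡0⇒n∣m n ℓ))
    where
    whenZero-nonZero : ∀ r {x} → r ≢ 0 → whenZero r x ≡ 0#
    whenZero-nonZero zero    r≢0 = contradiction ≡.refl r≢0
    whenZero-nonZero (suc r) _   = ≡.refl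

  spread-cong : ∀ {a b} → a ≈ₛ b → spread a ≈ₛ spread b
  spread-cong {a} {b} a≈b n with multipleView n
  ... | multiple q      = trans (spread-multiple a q) (trans (a≈b q) (sym (spread-multiple b q)))
  ... | nonMultiple ℓ∤n = trans (spread-nonMultiple a ℓ∤n) (sym (spread-nonMultiple b ℓ∤n))

  sum-spread : ∀ (a w : Series) q →
    sumTo (λ i → a i * spread w i) (q *ℕ ℓ) ≈ sumTo (λ m → a (m *ℕ ℓ) * w m) q
  sum-spread a w zero    = *-congˡ (spread-multiple w 0)
  sum-spread a w (suc q) = begin
    sumTo A (ℓ +ℕ q *ℕ ℓ)
      ≡⟨ ≡.cong (sumTo A) (ℕ.+-comm ℓ (q *ℕ ℓ)) ⟩
    sumTo A (q *ℕ ℓ +ℕ suc ℓ₁)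
      ≈⟨ sum-split A (q *ℕ ℓ) ℓ₁ ⟩
    sumTo A (q *ℕ ℓ) + sumTo (λ j → A (suc (q *ℕ ℓ) +ℕ j)) ℓ₁
      ≈⟨ +-cong (sum-spread a w q) (sum-single _ ℓ₁ ℕ.≤-refl vanish) ⟩
    B q + A (suc (q *ℕ ℓ) +ℕ ℓ₁)
      ≡⟨ ≡.cong (λ i → B q + A (suc i)) (ℕ.+-comm (q *ℕ ℓ) ℓ₁) ⟩
    B q + A (suc q *ℕ ℓ)
      ≈⟨ +-congˡ (*-congˡ (spread-multiple w (suc q))) ⟩
    B q + a (suc q *ℕ ℓ) * w (suc q) ∎
    where
    open ≈-Reasoning
    A : ℕ → Carrier
    A i = a i * spread w i
    B : ℕ → Carrier
    B = sumTo (λ m → a (m *ℕ ℓ) * w m)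
    vanish : ∀ j → j ≤ ℓ₁ → j ≢ ℓ₁ → A (suc (q *ℕ ℓ) +ℕ j) ≈ 0#
    vanish j j≤ℓ₁ j≢ℓ₁ = trans (*-congˡ (spread-nonMultiple w ℓ∤)) (zeroʳ _)
      where
      ℓ∤ : ℓ ∤ suc (q *ℕ ℓ) +ℕ j
      ℓ∤ ℓ∣ = >⇒∤ (s≤s (ℕ.≤∧≢⇒< j≤ℓ₁ j≢ℓ₁))
        (∣m+n∣m⇒∣n (≡.subst (ℓ ∣_) (≡.sym (ℕ.+-suc (q *ℕ ℓ) j)) ℓ∣) (n∣m*n q))

  spread-⋆ : ∀ a b → spread (a ⋆ b) ≈ₛ spread a ⋆ spread b
  spread-⋆ a b n with multipleView n
  ... | multiple q = begin
    spread (a ⋆ b) (q *ℕ ℓ)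
      ≈⟨ spread-multiple (a ⋆ b) q ⟩
    sumTo (λ m → a m * b (q ∸ m)) q
      ≈⟨ sum-cong q (λ m → trans (*-congʳ (b-at m)) (*-comm _ _)) ⟨
    sumTo (λ m → spread b (q *ℕ ℓ ∸ m *ℕ ℓ) * a m) q
      ≈⟨ sum-spread (λ i → spread b (q *ℕ ℓ ∸ i)) a q ⟨
    sumTo (λ i → spread b (q *ℕ ℓ ∸ i) * spread a i) (q *ℕ ℓ)
      ≈⟨ sum-cong (q *ℕ ℓ) (λ i → *-comm _ _) ⟩
    (spread a ⋆ spread b) (q *ℕ ℓ) ∎
    where
    open ≈-Reasoning
    b-at : ∀ m → spread b (q *ℕ ℓ ∸ m *ℕ ℓ) ≈ b (q ∸ m)
    b-at m = trans (reflexive (≡.cong (spread b) (≡.sym (ℕ.*-distribʳ-∸ ℓ q m)))) (spread-multiple b (q ∸ m))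
  ... | nonMultiple ℓ∤n = trans (spread-nonMultiple (a ⋆ b) ℓ∤n) (sym (sum-zero _ n vanish))
    where
    vanish : ∀ i → i ≤ n → spread a i * spread b (n ∸ i) ≈ 0#
    vanish i i≤n with ℓ ∣? i
    ... | no  ℓ∤i = trans (*-congʳ (spread-nonMultiple a ℓ∤i)) (zeroˡ _)
    ... | yes ℓ∣i =
      trans (*-congˡ (spread-nonMultiple b (λ ℓ∣n∸i → ℓ∤n (∣m∸n∣n⇒∣m ℓ i≤n ℓ∣n∸i ℓ∣i)))) (zeroʳ _)

  oneS∈ : InTl oneS
  oneS∈ zero    ℓ∤0 = contradiction (ℓ ∣0) ℓ∤0
  oneS∈ (suc n) _   = refl

  spread-oneS : spread oneS ≈ₛ oneS
  spread-oneS n with multipleView n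
  ... | multiple zero    = refl
  ... | multiple (suc q) = spread-multiple oneS (suc q)
  ... | nonMultiple ℓ∤n  = trans (spread-nonMultiple oneS ℓ∤n) (sym (oneS∈ n ℓ∤n))

  spread-·ₛ : ∀ x a → spread (x ·ₛ a) ≈ₛ x ·ₛ spread a
  spread-·ₛ x a n with multipleView n
  ... | multiple q      = trans (spread-multiple (x ·ₛ a) q) (*-congˡ (sym (spread-multiple a q)))
  ... | nonMultiple ℓ∤n =
    trans (spread-nonMultiple (x ·ₛ a) ℓ∤n) (sym (trans (*-congˡ (spread-nonMultiple a ℓ∤n)) (zeroʳ _)))

  module spread-Homomorphism = ⋆-Homomorphism spread spread-oneS spread-⋆

  spread-Σ∞ : ∀ F → Summable F → spread (Σ∞ F) ≈ₛ Σ∞ (spread ∘ F)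
  spread-Σ∞ F summable n with multipleView n
  ... | multiple q      = trans (spread-multiple (Σ∞ F) q) (sym (trans
    (sum-cong (q *ℕ ℓ) (λ m → spread-multiple (F m) q)) (Σ∞-truncate F summable q (ℕ.m≤m*n q ℓ))))
  ... | nonMultiple ℓ∤n =
    trans (spread-nonMultiple (Σ∞ F) ℓ∤n) (sym (sum-zero _ n (λ m _ → spread-nonMultiple (F m) ℓ∤n)))

  ∘ₛ-spread : ∀ w {Q} → Q 0 ≈ 0# → w ∘ₛ spread Q ≈ₛ spread (w ∘ₛ Q)
  ∘ₛ-spread w {Q} Q₀≈0 = ≈ₛ-sym (≈ₛ-trans (spread-Σ∞ _ (∘ₛ-summable w Q₀≈0))
    (Σ∞-cong (λ m → ≈ₛ-trans (spread-·ₛ (w m) (Q ^S m)) (·ₛ-congˡ (spread-Homomorphism.h-^S Q m)))))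

  spread-shift : ∀ a → spread (shift a) ≈ₛ shiftBy ℓ (spread a)
  spread-shift a n with multipleView n
  ... | multiple zero    =
    trans (spread-multiple (shift a) 0) (sym (reflexive (shiftBy-below ℓ (spread a) 0 (s≤s z≤n))))
  ... | multiple (suc q) = trans (spread-multiple (shift a) (suc q))
    (sym (trans (reflexive (shiftBy-+ ℓ (spread a) (q *ℕ ℓ))) (spread-multiple a q)))
  ... | nonMultiple ℓ∤n = trans (spread-nonMultiple (shift a) ℓ∤n) (sym shifted≈0)
    where
    shifted≈0 : shiftBy ℓ (spread a) n ≈ 0#
    shifted≈0 with n <? ℓ
    ... | yes n<ℓ = reflexive (shiftBy-below ℓ (spread a) n n<ℓ)
    ... | no  n≮ℓ = trans (reflexive (shiftBy-≥ ℓ (spread a) ℓ≤n))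
      (spread-nonMultiple a (λ ℓ∣n∸ℓ → ℓ∤n (∣m∸n∣n⇒∣m ℓ ℓ≤n ℓ∣n∸ℓ ∣-refl)))
      where
      ℓ≤n : ℓ ≤ n
      ℓ≤n = ℕ.≮⇒≥ n≮ℓ

  InTl-cong : ∀ {a b} → a ≈ₛ b → InTl a → InTl b
  InTl-cong a≈b a∈ n ℓ∤n = trans (sym (a≈b n)) (a∈ n ℓ∤n)

  InTl-spread : ∀ w → InTl (spread w)
  InTl-spread w n = spread-nonMultiple w

  InTl⇒≈spread : ∀ {b} → InTl b → b ≈ₛ spread (decimate b)
  InTl⇒≈spread {b} b∈ n with multipleView n
  ... | multiple q      = sym (spread-multiple (decimate b) q)
  ... | nonMultiple ℓ∤n = trans (b∈ n ℓ∤n) (sym (spread-nonMultiple (decimate b) ℓ∤n))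

  ValidF-cong : ∀ {f f′} → f ≈ₛ f′ → ValidF f → ValidF f′
  ValidF-cong f≈f′ (f₀≈0 , f∈ , f₁≉0) =
    trans (sym (f≈f′ 0)) f₀≈0 ,
    (λ n ℓ∤n → trans (sym (f≈f′ (suc n))) (f∈ n ℓ∤n)) ,
    (λ f′₁≈0 → f₁≉0 (trans (f≈f′ 1) f′₁≈0))

  ValidF⇒≈shift-spread : ∀ {f} → ValidF f → f ≈ₛ shift (spread (decimate (f ∘ suc)))
  ValidF⇒≈shift-spread (f₀≈0 , _  , _) zero    = f₀≈0
  ValidF⇒≈shift-spread (_    , f∈ , _) (suc n) = InTl⇒≈spread f∈ n

  ValidF-shift-spread : ∀ {w} → w 0 ≉ 0# → ValidF (shift (spread w))
  ValidF-shift-spread {w} w₀≉0 =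
    refl , InTl-spread w , (λ w₀≈0 → w₀≉0 (trans (sym (spread-multiple w 0)) w₀≈0))

module Exponents {c l} (R : CommutativeRing c l) (ℓ₁ : ℕ) where

  open Spreading R ℓ₁ using (ℓ)
  open MaR R ℓ using (expo)
  open CommutativeSemigroupProperties ℕ.+-commutativeSemigroup using (xy∙z≈xz∙y)
    renaming (interchange to +-interchangeℕ)

  expo-+ : ∀ j r m → expo j (r +ℕ m *ℕ ℓ) ≡ expo j r +ℕ m
  expo-+ j r m = begin-equality
    (r +ℕ m *ℕ ℓ +ℕ C) / ℓ      ≡⟨ /-congˡ (xy∙z≈xz∙y r (m *ℕ ℓ) C) ⟩
    (r +ℕ C +ℕ m *ℕ ℓ) / ℓ      ≡⟨ +-distrib-/-∣ʳ (r +ℕ C) (n∣m*n m) ⟩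
    (r +ℕ C) / ℓ +ℕ m *ℕ ℓ / ℓ  ≡⟨ ≡.cong ((r +ℕ C) / ℓ +ℕ_) (m*n/n≡m m ℓ) ⟩
    (r +ℕ C) / ℓ +ℕ m           ∎
    where
    open ℕ.≤-Reasoning
    C = ℓ ∸ suc (toℕ j)

  𝟙[_<_] : ℕ → ℕ → ℕ
  𝟙[ j     < zero  ] = 0
  𝟙[ zero  < suc r ] = 1
  𝟙[ suc j < suc r ] = 𝟙[ j < r ]

  𝟙<-yes : ∀ {j r} → j < r → 𝟙[ j < r ] ≡ 1
  𝟙<-yes {zero}  {suc r} _         = ≡.refl
  𝟙<-yes {suc j} {suc r} (s≤s j<r) = 𝟙<-yes j<r

  𝟙<-no : ∀ {j r} → r ≤ j → 𝟙[ j < r ] ≡ 0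
  𝟙<-no {j}     {zero}  _         = ≡.refl
  𝟙<-no {suc j} {suc r} (s≤s r≤j) = 𝟙<-no r≤j

  expo-below-ℓ : ∀ j {r} → r < ℓ → expo j r ≡ 𝟙[ toℕ j < r ]
  expo-below-ℓ j {r} r<ℓ with toℕ j <? r
  ... | yes J<r = begin-equality
    (r +ℕ C) / ℓ                ≡⟨ /-congˡ r+C≡ ⟩
    (r ∸ suc J +ℕ ℓ) / ℓ        ≡⟨ +-distrib-/-∣ʳ (r ∸ suc J) ∣-refl ⟩
    (r ∸ suc J) / ℓ +ℕ ℓ / ℓ    ≡⟨ ≡.cong₂ _+ℕ_ (m<n⇒m/n≡0 (ℕ.≤-<-trans (ℕ.m∸n≤m r (suc J)) r<ℓ)) (n/n≡1 ℓ) ⟩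
    1                           ≡⟨ 𝟙<-yes J<r ⟨
    𝟙[ J < r ]                  ∎
    where
    open ℕ.≤-Reasoning
    J = toℕ j
    C = ℓ ∸ suc J
    r+C≡ : r +ℕ C ≡ r ∸ suc J +ℕ ℓ
    r+C≡ = ≡.trans (≡.cong (_+ℕ C) (≡.sym (ℕ.m∸n+n≡m J<r)))
      (≡.trans (ℕ.+-assoc (r ∸ suc J) (suc J) C) (≡.cong (r ∸ suc J +ℕ_) (ℕ.m+[n∸m]≡n (toℕ<n j))))
  ... | no  J≮r = ≡.trans (m<n⇒m/n≡0 r+C<ℓ) (≡.sym (𝟙<-no (ℕ.≮⇒≥ J≮r)))
    where
    J = toℕ j
    C = ℓ ∸ suc J
    r+C<ℓ : r +ℕ C < ℓ
    r+C<ℓ = ≡.subst (r +ℕ C <_) (ℕ.m+[n∸m]≡n (toℕ<n j)) (ℕ.+-monoˡ-≤ C (s≤s (ℕ.≮⇒≥ J≮r)))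

  sum-𝟙< : ∀ m {r} → r ≤ m → sum (λ (j : Fin m) → 𝟙[ toℕ j < r ]) ≡ r
  sum-𝟙< zero    z≤n               = ≡.refl
  sum-𝟙< (suc m) {zero}  _         = sum-replicate-zero (suc m)
  sum-𝟙< (suc m) {suc r} (s≤s r≤m) = ≡.cong suc (sum-𝟙< m r≤m)

  sum-+const : ∀ m (e : Fin m → ℕ) q → sum (λ j → e j +ℕ q) ≡ sum e +ℕ m *ℕ q
  sum-+const zero    e q = ≡.refl
  sum-+const (suc m) e q = ≡.trans (≡.cong ((e fzero +ℕ q) +ℕ_) (sum-+const m (e ∘ fsuc) q))
    (+-interchangeℕ (e fzero) q (sum (e ∘ fsuc)) (m *ℕ q))

  sum-expo : ∀ k → sum (λ j → expo j k) ≡ k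
  sum-expo k = begin-equality
    sum (λ j → expo j k)                  ≡⟨ sum-cong-≗ {ℓ} (λ j → ≡.cong (expo j) k≡r+qℓ) ⟩
    sum (λ j → expo j (r +ℕ q *ℕ ℓ))      ≡⟨ sum-cong-≗ {ℓ} (λ j → expo-+ j r q) ⟩
    sum (λ j → expo j r +ℕ q)             ≡⟨ sum-+const ℓ (λ j → expo j r) q ⟩
    sum (λ j → expo j r) +ℕ ℓ *ℕ q        ≡⟨ ≡.cong (_+ℕ ℓ *ℕ q) (sum-cong-≗ {ℓ} (λ j → expo-below-ℓ j r<ℓ)) ⟩
    sum (λ (j : Fin ℓ) → 𝟙[ toℕ j < r ]) +ℕ ℓ *ℕ q ≡⟨ ≡.cong₂ _+ℕ_ (sum-𝟙< ℓ (ℕ.<⇒≤ r<ℓ)) (ℕ.*-comm ℓ q) ⟩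
    r +ℕ q *ℕ ℓ                           ≡⟨ k≡r+qℓ ⟨
    k                                     ∎
    where
    open ℕ.≤-Reasoning
    r = k % ℓ
    q = k / ℓ
    r<ℓ : r < ℓ
    r<ℓ = m%n<n k ℓ
    k≡r+qℓ : k ≡ r +ℕ q *ℕ ℓ
    k≡r+qℓ = m≡m%n+[m/n]*n k ℓ

module ArrayColumns {c l} (R : CommutativeRing c l) (ℓ₁ : ℕ) where

  open CommutativeRing R hiding (zero)
  open Spreading R ℓ₁
  open MaR R ℓ
  open FormalPowerSeries R ℓ
  open InfiniteMatrices R ℓ
  open Exponents R ℓ₁

  prodFin-t^expo : ∀ k → prodFin ℓ (λ j → tS ^S expo j k) ≈ₛ tS ^S k
  prodFin-t^expo k = ≈ₛ-trans (prodFin-^S-sum ℓ tS (λ j → expo j k))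
    (λ n → reflexive (≡.cong (λ e → (tS ^S e) n) (sum-expo k)))

  array-cong : ∀ {b b′ g g′} {f f′ : Fin ℓ → Series} → b ≈ₛ b′ → g ≈ₛ g′ → (∀ j → f j ≈ₛ f′ j) →
    array b g f ≋ array b′ g′ f′
  array-cong b≈b′ g≈g′ f≈f′ n zero    = b≈b′ n
  array-cong b≈b′ g≈g′ f≈f′ n (suc k) =
    shift-cong (⋆-cong g≈g′ (prodFin-cong ℓ (λ j → ^S-cong (expo j k) (f≈f′ j)))) n

  identity-array : array oneS oneS (λ _ → tS) ≋ idM
  identity-array zero    zero    = refl
  identity-array (suc n) zero    = refl
  identity-array n       (suc k) = trans (shift-cong t^k n) (shiftBy-oneS≈idM (suc k) n)
    where
    t^k : oneS ⋆ prodFin ℓ (λ j → tS ^S expo j k) ≈ₛ shiftBy k oneS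
    t^k = ≈ₛ-trans (⋆-identityˡ _) (≈ₛ-trans (prodFin-t^expo k)
            (≈ₛ-trans (≈ₛ-sym (⋆-identityʳ (tS ^S k))) (t^⋆≈shiftBy k oneS)))

  -- F k and Φ k belong to column k + 1, as expo j k is eⱼ(k + 1).
  module Array (b g : Series) (f : Fin ℓ → Series) (g∈ : InTl g) (f-valid : ∀ j → ValidF (f j)) where

    A : Matrix
    A = array b g f

    γ : Series
    γ = decimate g

    φ : Fin ℓ → Series
    φ j = decimate (f j ∘ suc)

    g≈ : g ≈ₛ spread γ
    g≈ = InTl⇒≈spread g∈

    φ₀≉0 : ∀ j → φ j 0 ≉ 0#
    φ₀≉0 j = proj₂ (proj₂ (f-valid j))

    f≈ : ∀ j → f j ≈ₛ tS ⋆ spread (φ j)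
    f≈ j = ≈ₛ-trans (ValidF⇒≈shift-spread (f-valid j)) (shift≈t⋆ (spread (φ j)))

    F : ℕ → Series
    F k = prodFin ℓ (λ j → f j ^S expo j k)

    Φ : ℕ → Series
    Φ k = prodFin ℓ (λ j → φ j ^S expo j k)

    F≈ : ∀ k → F k ≈ₛ shiftBy k (spread (Φ k))
    F≈ k = begin
      F k
        ≈⟨ prodFin-cong ℓ (λ j →
             ≈ₛ-trans (^S-cong (expo j k) (f≈ j)) (^S-distrib-⋆ tS (spread (φ j)) (expo j k))) ⟩
      prodFin ℓ (λ j → (tS ^S expo j k) ⋆ (spread (φ j) ^S expo j k))
        ≈⟨ prodFin-distrib-⋆ ℓ (λ j → tS ^S expo j k) (λ j → spread (φ j) ^S expo j k) ⟩
      prodFin ℓ (λ j → tS ^S expo j k) ⋆ prodFin ℓ (λ j → spread (φ j) ^S expo j k)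
        ≈⟨ ⋆-cong (prodFin-t^expo k) (≈ₛ-sym (spread-Homomorphism.h-prodFin-^S ℓ φ (λ j → expo j k))) ⟩
      (tS ^S k) ⋆ spread (Φ k)
        ≈⟨ t^⋆≈shiftBy k (spread (Φ k)) ⟩
      shiftBy k (spread (Φ k)) ∎
      where open ≈ₛ-Reasoning

    P : Series
    P = prodFin ℓ f

    Q : Series
    Q = shift (prodFin ℓ φ)

    P≈spreadQ : P ≈ₛ spread Q
    P≈spreadQ = begin
      P
        ≈⟨ prodFin-cong ℓ f≈ ⟩
      prodFin ℓ (λ j → tS ⋆ spread (φ j))
        ≈⟨ prodFin-distrib-⋆ ℓ (λ _ → tS) (spread ∘ φ) ⟩
      prodFin ℓ (λ _ → tS) ⋆ prodFin ℓ (spread ∘ φ)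
        ≈⟨ ⋆-cong (prodFin-const ℓ tS) (≈ₛ-sym (spread-Homomorphism.h-prodFin ℓ φ)) ⟩
      (tS ^S ℓ) ⋆ spread (prodFin ℓ φ)
        ≈⟨ t^⋆≈shiftBy ℓ (spread (prodFin ℓ φ)) ⟩
      shiftBy ℓ (spread (prodFin ℓ φ))
        ≈⟨ spread-shift (prodFin ℓ φ) ⟨
      spread Q ∎
      where
      open ≈ₛ-Reasoning

    P₀≈0 : P 0 ≈ 0#
    P₀≈0 = trans (P≈spreadQ 0) (spread-multiple Q 0)

    column-suc : ∀ k → column A (suc k) ≈ₛ shiftBy (suc k) (spread (γ ⋆ Φ k))
    column-suc k = shift-cong (begin
      g ⋆ F k                              ≈⟨ ⋆-cong g≈ (F≈ k) ⟩
      spread γ ⋆ shiftBy k (spread (Φ k))  ≈⟨ ⋆-comm (spread γ) _ ⟩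
      shiftBy k (spread (Φ k)) ⋆ spread γ  ≈⟨ shiftBy-⋆ k (spread (Φ k)) (spread γ) ⟩
      shiftBy k (spread (Φ k) ⋆ spread γ)  ≈⟨ shiftBy-cong k (⋆-comm (spread (Φ k)) (spread γ)) ⟩
      shiftBy k (spread γ ⋆ spread (Φ k))  ≈⟨ shiftBy-cong k (spread-⋆ γ (Φ k)) ⟨
      shiftBy k (spread (γ ⋆ Φ k))         ∎)
      where open ≈ₛ-Reasoning

    A-lower : LowerTriangular A
    A-lower {n} {suc k} n<k = trans (column-suc k n) (reflexive (shiftBy-below (suc k) _ n n<k))

    A-diagonal : ∀ k → A (suc k) (suc k) ≈ γ 0 * Φ k 0
    A-diagonal k = trans (column-suc k (suc k))
      (trans (reflexive (shiftBy-diagonal (suc k) (spread (γ ⋆ Φ k)))) (spread-multiple (γ ⋆ Φ k) 0))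

    column-InTl : InTl b → ∀ {k} → ℓ ∣ k → InTl (column A k)
    column-InTl b∈ {zero}  _   = b∈
    column-InTl b∈ {suc k} ℓ∣k n ℓ∤n with n <? suc k
    ... | yes n<k = A-lower n<k
    ... | no  n≮k = trans (column-suc k n) (trans (reflexive (shiftBy-≥ (suc k) _ k≤n))
      (spread-nonMultiple (γ ⋆ Φ k) (λ ℓ∣n∸k → ℓ∤n (∣m∸n∣n⇒∣m ℓ k≤n ℓ∣n∸k ℓ∣k))))
      where
      k≤n : suc k ≤ n
      k≤n = ℕ.≮⇒≥ n≮k

    F-+ : ∀ r m → F (r +ℕ m *ℕ ℓ) ≈ₛ F r ⋆ (P ^S m)
    F-+ r m = ≈ₛ-trans (prodFin-cong ℓ (λ j n → reflexive (≡.cong (λ e → (f j ^S e) n) (expo-+ j r m))))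
      (prodFin-^S-+ ℓ f (λ j → expo j r) m)

    column-+ : ∀ r m → column A (suc r +ℕ m *ℕ ℓ) ≈ₛ shift ((g ⋆ F r) ⋆ (P ^S m))
    column-+ r m = shift-cong (≈ₛ-trans (⋆-congˡ g (F-+ r m)) (≈ₛ-sym (⋆-assoc g (F r) (P ^S m))))

    *ᵛ-shiftBy-spread : ∀ r w → A *ᵛ shiftBy (suc r) (spread w) ≈ₛ shift ((g ⋆ F r) ⋆ (w ∘ₛ P))
    *ᵛ-shiftBy-spread r w n = begin
      sumTo (λ j → A n j * x j) n
        ≈⟨ sum-extend _ (suc r +ℕ n *ℕ ℓ) n≤ (λ j n<j _ → trans (*-congʳ (A-lower n<j)) (zeroˡ _)) ⟨
      sumTo (λ j → A n j * x j) (suc r +ℕ n *ℕ ℓ)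
        ≈⟨ sum-drop _ (suc r) (n *ℕ ℓ) (λ i i<r → trans (*-congˡ (reflexive (shiftBy-below (suc r) _ i i<r)))
                                                          (zeroʳ _)) ⟩
      sumTo (λ i → A n (suc r +ℕ i) * x (suc r +ℕ i)) (n *ℕ ℓ)
        ≈⟨ sum-cong (n *ℕ ℓ) (λ i → *-congˡ (reflexive (shiftBy-+ (suc r) (spread w) i))) ⟩
      sumTo (λ i → A n (suc r +ℕ i) * spread w i) (n *ℕ ℓ)
        ≈⟨ sum-spread (λ i → A n (suc r +ℕ i)) w n ⟩
      sumTo (λ m → A n (suc r +ℕ m *ℕ ℓ) * w m) n
        ≈⟨ sum-cong n (λ m → *-congʳ (column-+ r m n)) ⟩
      sumTo (λ m → shift (X ⋆ (P ^S m)) n * w m) n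
        ≈⟨ shifted n ⟩
      shift (X ⋆ (w ∘ₛ P)) n ∎
      where
      open ≈-Reasoning
      x = shiftBy (suc r) (spread w)
      X = g ⋆ F r
      n≤ : n ≤ suc r +ℕ n *ℕ ℓ
      n≤ = ℕ.≤-trans (ℕ.m≤m*n n ℓ) (ℕ.m≤n+m (n *ℕ ℓ) (suc r))
      shifted : ∀ n → sumTo (λ m → shift (X ⋆ (P ^S m)) n * w m) n ≈ shift (X ⋆ (w ∘ₛ P)) n
      shifted zero    = zeroˡ _
      shifted (suc n) = sym (⋆-∘ₛ-expand X w P₀≈0 (ℕ.n≤1+n n))

  module Product (b g : Series) (f : Fin ℓ → Series) (g∈ : InTl g) (f-valid : ∀ j → ValidF (f j))
                 (b′ g′ : Series) (f′ : Fin ℓ → Series) (g′∈ : InTl g′) (f′-valid : ∀ j → ValidF (f′ j))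
                 where

    module M = Array b g f g∈ f-valid
    module N = Array b′ g′ f′ g′∈ f′-valid
    open ∘ₛ-Homomorphism {M.P} M.P₀≈0 using () renaming (h-prodFin-^S to ∘P-prodFin-^S)

    b″ : Series
    b″ = M.A *ᵛ b′

    g″ : Series
    g″ = g ⋆ (N.γ ∘ₛ M.P)

    f″ : Fin ℓ → Series
    f″ j = f j ⋆ (N.φ j ∘ₛ M.P)

    regroup : ∀ k → (g ⋆ M.F k) ⋆ ((N.γ ⋆ N.Φ k) ∘ₛ M.P) ≈ₛ g″ ⋆ prodFin ℓ (λ j → f″ j ^S expo j k)
    regroup k = begin
      (g ⋆ M.F k) ⋆ ((N.γ ⋆ N.Φ k) ∘ₛ M.P)
        ≈⟨ ⋆-congˡ (g ⋆ M.F k)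
             (≈ₛ-trans (⋆-∘ₛ N.γ (N.Φ k) M.P₀≈0) (⋆-congˡ (N.γ ∘ₛ M.P) (∘P-prodFin-^S ℓ N.φ e))) ⟩
      (g ⋆ M.F k) ⋆ ((N.γ ∘ₛ M.P) ⋆ prodFin ℓ (λ j → (N.φ j ∘ₛ M.P) ^S e j))
        ≈⟨ ⋆-interchange g (M.F k) (N.γ ∘ₛ M.P) (prodFin ℓ (λ j → (N.φ j ∘ₛ M.P) ^S e j)) ⟩
      g″ ⋆ (M.F k ⋆ prodFin ℓ (λ j → (N.φ j ∘ₛ M.P) ^S e j))
        ≈⟨ ⋆-congˡ g″ (prodFin-distrib-⋆ ℓ (λ j → f j ^S e j) (λ j → (N.φ j ∘ₛ M.P) ^S e j)) ⟨
      g″ ⋆ prodFin ℓ (λ j → (f j ^S e j) ⋆ ((N.φ j ∘ₛ M.P) ^S e j))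
        ≈⟨ ⋆-congˡ g″ (prodFin-cong ℓ (λ j → ^S-distrib-⋆ (f j) (N.φ j ∘ₛ M.P) (e j))) ⟨
      g″ ⋆ prodFin ℓ (λ j → f″ j ^S e j) ∎
      where
      open ≈ₛ-Reasoning
      e : Fin ℓ → ℕ
      e j = expo j k

    product : (M.A ⊗ N.A) ≋ array b″ g″ f″
    product n zero    = refl
    product n (suc k) = begin
      (M.A *ᵛ column N.A (suc k)) n                      ≈⟨ *ᵛ-congˡ M.A (N.column-suc k) n ⟩
      (M.A *ᵛ shiftBy (suc k) (spread (N.γ ⋆ N.Φ k))) n  ≈⟨ M.*ᵛ-shiftBy-spread k (N.γ ⋆ N.Φ k) n ⟩
      shift ((g ⋆ M.F k) ⋆ ((N.γ ⋆ N.Φ k) ∘ₛ M.P)) n     ≈⟨ shift-cong (regroup k) n ⟩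
      array b″ g″ f″ n (suc k)                           ∎
      where open ≈-Reasoning

    b″∈ : InTl b → InTl b′ → InTl b″
    b″∈ b∈ b′∈ n ℓ∤n = sum-zero _ n vanish
      where
      vanish : ∀ j → j ≤ n → M.A n j * b′ j ≈ 0#
      vanish j _ with ℓ ∣? j
      ... | yes ℓ∣j = trans (*-congʳ (M.column-InTl b∈ ℓ∣j n ℓ∤n)) (zeroˡ _)
      ... | no  ℓ∤j = trans (*-congˡ (b′∈ j ℓ∤j)) (zeroʳ _)

    ∘P≈spread : ∀ w → w ∘ₛ M.P ≈ₛ spread (w ∘ₛ M.Q)
    ∘P≈spread w = ≈ₛ-trans (∘ₛ-cong ≈ₛ-refl M.P≈spreadQ) (∘ₛ-spread w refl)

    g″≈spread : g″ ≈ₛ spread (M.γ ⋆ (N.γ ∘ₛ M.Q))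
    g″≈spread = ≈ₛ-trans (⋆-cong M.g≈ (∘P≈spread N.γ)) (≈ₛ-sym (spread-⋆ M.γ (N.γ ∘ₛ M.Q)))

    g″∈ : InTl g″
    g″∈ = InTl-cong (≈ₛ-sym g″≈spread) (InTl-spread (M.γ ⋆ (N.γ ∘ₛ M.Q)))

    g″₀ : g″ 0 ≈ g 0 * g′ 0
    g″₀ = *-congˡ (*-identityʳ _)

    f″≈shift-spread : ∀ j → f″ j ≈ₛ shift (spread (M.φ j ⋆ (N.φ j ∘ₛ M.Q)))
    f″≈shift-spread j = begin
      f j ⋆ (N.φ j ∘ₛ M.P)                      ≈⟨ ⋆-cong (M.f≈ j) (∘P≈spread (N.φ j)) ⟩
      (tS ⋆ spread (M.φ j)) ⋆ spread (ψ j)      ≈⟨ ⋆-assoc tS (spread (M.φ j)) (spread (ψ j)) ⟩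
      tS ⋆ (spread (M.φ j) ⋆ spread (ψ j))      ≈⟨ ⋆-congˡ tS (spread-⋆ (M.φ j) (ψ j)) ⟨
      tS ⋆ spread (M.φ j ⋆ ψ j)                 ≈⟨ shift≈t⋆ (spread (M.φ j ⋆ ψ j)) ⟨
      shift (spread (M.φ j ⋆ ψ j))              ∎
      where
      open ≈ₛ-Reasoning
      ψ : Fin ℓ → Series
      ψ j = N.φ j ∘ₛ M.Q

    product≋idM : b″ ≈ₛ oneS → M.γ ⋆ (N.γ ∘ₛ M.Q) ≈ₛ oneS → (∀ j → M.φ j ⋆ (N.φ j ∘ₛ M.Q) ≈ₛ oneS) →
      (M.A ⊗ N.A) ≋ idM
    product≋idM b″≈1 γ-inverse φ-inverse =
      ≋-trans product (≋-trans (array-cong b″≈1 g″≈1 f″≈t) identity-array)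
      where
      g″≈1 : g″ ≈ₛ oneS
      g″≈1 = ≈ₛ-trans g″≈spread (≈ₛ-trans (spread-cong γ-inverse) spread-oneS)
      f″≈t : ∀ j → f″ j ≈ₛ tS
      f″≈t j = ≈ₛ-trans (f″≈shift-spread j)
        (≈ₛ-trans (shift-cong (≈ₛ-trans (spread-cong (φ-inverse j)) spread-oneS)) shift-oneS)

module FieldFacts {c l} (R : CommutativeRing c l) (isField : IsField R) where

  open CommutativeRing R hiding (zero)
  open IsField isField
  open SetoidReasoning setoid

  1≉0 : 1# ≉ 0#
  1≉0 1≈0 = 0≉1 (sym 1≈0)

  ≈1⇒≉0 : ∀ {x} → x ≈ 1# → x ≉ 0#
  ≈1⇒≉0 x≈1 x≈0 = 1≉0 (trans (sym x≈1) x≈0)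

  *≈1⇒≉0ʳ : ∀ {x y} → x * y ≈ 1# → y ≉ 0#
  *≈1⇒≉0ʳ {x} x*y≈1 y≈0 = 1≉0 (trans (sym x*y≈1) (trans (*-congˡ y≈0) (zeroʳ x)))

  *≈1⇒≈1ʳ : ∀ {x y} → x ≈ 1# → x * y ≈ 1# → y ≈ 1#
  *≈1⇒≈1ʳ {x} {y} x≈1 x*y≈1 = trans (sym (*-identityˡ y)) (trans (*-congʳ (sym x≈1)) x*y≈1)

  *-cancelˡ-≈0 : ∀ {x y} → x ≉ 0# → x * y ≈ 0# → y ≈ 0#
  *-cancelˡ-≈0 {x} {y} x≉0 x*y≈0 with inverse x x≉0
  ... | x⁻¹ , x*x⁻¹≈1 = begin
    y              ≈⟨ *-identityˡ y ⟨
    1# * y         ≈⟨ *-congʳ (trans (sym x*x⁻¹≈1) (*-comm x x⁻¹)) ⟩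
    (x⁻¹ * x) * y  ≈⟨ *-assoc x⁻¹ x y ⟩
    x⁻¹ * (x * y)  ≈⟨ *-congˡ x*y≈0 ⟩
    x⁻¹ * 0#       ≈⟨ zeroʳ x⁻¹ ⟩
    0#             ∎

  *-≉0 : ∀ {x y} → x ≉ 0# → y ≉ 0# → x * y ≉ 0#
  *-≉0 x≉0 y≉0 = y≉0 ∘ *-cancelˡ-≈0 x≉0

module Inverses {c l} (R : CommutativeRing c l) (isField : IsField R) (ℓ₁ : ℕ) where

  open CommutativeRing R hiding (zero)
  open IsField isField
  open FieldFacts R isField
  open Spreading R ℓ₁
  open MaR R ℓ
  open FormalPowerSeries R ℓ
  open InfiniteMatrices R ℓ
  open ArrayColumns R ℓ₁
  open GroupProperties +-group using (\\-leftDividesˡ)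

  ^S-≉0 : ∀ a n → a 0 ≉ 0# → (a ^S n) 0 ≉ 0#
  ^S-≉0 a zero    _     = 1≉0
  ^S-≉0 a (suc n) a₀≉0 = *-≉0 a₀≉0 (^S-≉0 a n a₀≉0)

  prodFin-≉0 : ∀ m (f : Fin m → Series) → (∀ j → f j 0 ≉ 0#) → prodFin m f 0 ≉ 0#
  prodFin-≉0 zero    f _     = 1≉0
  prodFin-≉0 (suc m) f f₀≉0 = *-≉0 (f₀≉0 fzero) (prodFin-≉0 m (f ∘ fsuc) (f₀≉0 ∘ fsuc))

  module ForwardSubstitution (E : Matrix) (d : ℕ → Carrier) (E*d≈1 : ∀ n → E n n * d n ≈ 1#) (y : Series)
    where

    next : ℕ → Series → Carrier
    next n x = d (suc n) * (- sumTo (λ i → E (suc n) i * x i) n + y (suc n))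

    -- prefix n agrees with the solution at 0, …, n.
    prefix : ℕ → Series
    prefix zero    _ = d 0 * y 0
    prefix (suc n) j with j ℕ.≤? n
    ... | yes _ = prefix n j
    ... | no  _ = next n (prefix n)

    x : Series
    x n = prefix n n

    prefix-stable : ∀ n {j} → j ≤ n → prefix n j ≡ x j
    prefix-stable zero    z≤n = ≡.refl
    prefix-stable (suc n) {j} j≤1+n with ℕ.m≤n⇒m<n∨m≡n j≤1+n
    ... | inj₂ ≡.refl     = ≡.refl
    ... | inj₁ (s≤s j≤n) with j ℕ.≤? n
    ...   | yes _   = prefix-stable n j≤n
    ...   | no  j≰n = contradiction j≤n j≰n

    x-suc : ∀ n → x (suc n) ≡ next n (prefix n)
    x-suc n with suc n ℕ.≤? n
    ... | yes 1+n≤n = contradiction 1+n≤n ℕ.1+n≰n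
    ... | no  _     = ≡.refl

    solves : E *ᵛ x ≈ₛ y
    solves zero    = trans (sym (*-assoc _ _ _)) (trans (*-congʳ (E*d≈1 0)) (*-identityˡ _))
    solves (suc n) = begin
      sumTo (λ j → E (suc n) j * x j) n + E (suc n) (suc n) * x (suc n)
        ≈⟨ +-cong (sum-cong-≤ n (λ j j≤n → *-congˡ (reflexive (≡.sym (prefix-stable n j≤n)))))
                  (*-congˡ (reflexive (x-suc n))) ⟩
      S + E (suc n) (suc n) * (d (suc n) * (- S + y (suc n)))
        ≈⟨ +-congˡ (trans (sym (*-assoc _ _ _)) (trans (*-congʳ (E*d≈1 (suc n))) (*-identityˡ _))) ⟩
      S + (- S + y (suc n))
        ≈⟨ \\-leftDividesˡ S (y (suc n)) ⟩
      y (suc n) ∎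
      where
      open ≈-Reasoning
      S = sumTo (λ i → E (suc n) i * prefix n i) n

  *ᵛ-solve : ∀ (E : Matrix) → (∀ n → E n n ≉ 0#) → ∀ y → Σ Series λ x → E *ᵛ x ≈ₛ y
  *ᵛ-solve E Eₙₙ≉0 y = ForwardSubstitution.x E d E*d≈1 y , ForwardSubstitution.solves E d E*d≈1 y
    where
    d : ℕ → Carrier
    d n = proj₁ (inverse (E n n) (Eₙₙ≉0 n))
    E*d≈1 : ∀ n → E n n * d n ≈ 1#
    E*d≈1 n = proj₂ (inverse (E n n) (Eₙₙ≉0 n))

  InTl-*ᵛ⁻¹ : ∀ E x → (∀ n → E n n ≉ 0#) → (∀ {k} → ℓ ∣ k → InTl (column E k)) →
    InTl (E *ᵛ x) → InTl x
  InTl-*ᵛ⁻¹ E x Eₙₙ≉0 column-InTl Ex∈ = <-rec (λ n → ℓ ∤ n → x n ≈ 0#) step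
    where
    step : ∀ n → (∀ {m} → m < n → ℓ ∤ m → x m ≈ 0#) → ℓ ∤ n → x n ≈ 0#
    step zero    _    ℓ∤0 = contradiction (ℓ ∣0) ℓ∤0
    step (suc n) x<n≈0 ℓ∤n = *-cancelˡ-≈0 (Eₙₙ≉0 (suc n)) (begin
      E (suc n) (suc n) * x (suc n)                                     ≈⟨ +-identityˡ _ ⟨
      0# + E (suc n) (suc n) * x (suc n)                                ≈⟨ +-congʳ (sum-zero _ n earlier) ⟨
      sumTo (λ j → E (suc n) j * x j) n + E (suc n) (suc n) * x (suc n) ≈⟨ Ex∈ (suc n) ℓ∤n ⟩
      0#                                                                ∎)
      where
      open ≈-Reasoning
      earlier : ∀ j → j ≤ n → E (suc n) j * x j ≈ 0#
      earlier j j≤n with ℓ ∣? j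
      ... | yes ℓ∣j = trans (*-congʳ (column-InTl ℓ∣j (suc n) ℓ∤n)) (zeroˡ _)
      ... | no  ℓ∤j = trans (*-congˡ (x<n≈0 (s≤s j≤n) ℓ∤j)) (zeroʳ _)

  ∘ₛ-solve : ∀ α q ψ → α 0 ≉ 0# → q 0 ≉ 0# → Σ Series λ η → α ⋆ (η ∘ₛ shift q) ≈ₛ ψ
  ∘ₛ-solve α q ψ α₀≉0 q₀≉0 = η , λ n → trans (⋆-∘ₛ-expand α η {shift q} refl {n} ℕ.≤-refl) (η-solves n)
    where
    E : Matrix
    E n m = (α ⋆ (shift q ^S m)) n
    E-diagonal : ∀ n → E n n ≈ (q ^S n) 0 * α 0
    E-diagonal n = begin
      (α ⋆ (shift q ^S n)) n              ≈⟨ ⋆-comm α (shift q ^S n) n ⟩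
      ((shift q ^S n) ⋆ α) n              ≈⟨ ⋆-congʳ α (shift-^S q n) n ⟩
      (shiftBy n (q ^S n) ⋆ α) n          ≈⟨ shiftBy-⋆ n (q ^S n) α n ⟩
      shiftBy n ((q ^S n) ⋆ α) n          ≡⟨ shiftBy-diagonal n ((q ^S n) ⋆ α) ⟩
      (q ^S n) 0 * α 0                    ∎
      where open ≈-Reasoning
    Eₙₙ≉0 : ∀ n → E n n ≉ 0#
    Eₙₙ≉0 n Eₙₙ≈0 = *-≉0 (^S-≉0 q n q₀≉0) α₀≉0 (trans (sym (E-diagonal n)) Eₙₙ≈0)
    η : Series
    η = proj₁ (*ᵛ-solve E Eₙₙ≉0 ψ)
    η-solves : E *ᵛ η ≈ₛ ψ
    η-solves = proj₂ (*ᵛ-solve E Eₙₙ≉0 ψ)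

  ∘ₛ-inverse-constantTerm : ∀ {α η P} → α ⋆ (η ∘ₛ P) ≈ₛ oneS → α 0 * η 0 ≈ 1#
  ∘ₛ-inverse-constantTerm {α} {η} {P} α⋆η∘P≈1 = trans (*-congˡ (sym (∘ₛ-constantTerm η P))) (α⋆η∘P≈1 0)

  module ProductInMaR (b g : Series) (f : Fin ℓ → Series) (g∈ : InTl g) (f-valid : ∀ j → ValidF (f j))
                      (b′ g′ : Series) (f′ : Fin ℓ → Series) (g′∈ : InTl g′) (f′-valid : ∀ j → ValidF (f′ j))
                      where

    open Product b g f g∈ f-valid b′ g′ f′ g′∈ f′-valid public

    f″-valid : ∀ j → ValidF (f″ j)
    f″-valid j = ValidF-cong (≈ₛ-sym (f″≈shift-spread j)) (ValidF-shift-spread {M.φ j ⋆ (N.φ j ∘ₛ M.Q)}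
      (*-≉0 (M.φ₀≉0 j) (N.φ₀≉0 j ∘ trans (sym (∘ₛ-constantTerm (N.φ j) M.Q)))))

  module ArrayInverse (b g : Series) (f : Fin ℓ → Series) (g∈ : InTl g) (f-valid : ∀ j → ValidF (f j))
                      (b₀≉0 : b 0 ≉ 0#) (g₀≉0 : g 0 ≉ 0#) where

    open Array b g f g∈ f-valid

    A-diagonal-≉0 : ∀ n → A n n ≉ 0#
    A-diagonal-≉0 zero    = b₀≉0
    A-diagonal-≉0 (suc k) Akk≈0 = *-≉0 g₀≉0 Φ₀≉0 (trans (sym (A-diagonal k)) Akk≈0)
      where
      Φ₀≉0 : Φ k 0 ≉ 0#
      Φ₀≉0 = prodFin-≉0 ℓ (λ j → φ j ^S expo j k) (λ j → ^S-≉0 (φ j) (expo j k) (φ₀≉0 j))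

    b⁻ : Series
    b⁻ = proj₁ (*ᵛ-solve A A-diagonal-≉0 oneS)

    A*b⁻≈1 : A *ᵛ b⁻ ≈ₛ oneS
    A*b⁻≈1 = proj₂ (*ᵛ-solve A A-diagonal-≉0 oneS)

    b⁻∈ : InTl b → InTl b⁻
    b⁻∈ b∈ = InTl-*ᵛ⁻¹ A b⁻ A-diagonal-≉0 (column-InTl b∈) (InTl-cong (≈ₛ-sym A*b⁻≈1) oneS∈)

    b⁻₀≈1 : b 0 ≈ 1# → b⁻ 0 ≈ 1#
    b⁻₀≈1 b₀≈1 = *≈1⇒≈1ʳ b₀≈1 (A*b⁻≈1 0)

    ∘Q-solve : ∀ α → α 0 ≉ 0# → Σ Series λ η → α ⋆ (η ∘ₛ Q) ≈ₛ oneS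
    ∘Q-solve α α₀≉0 = ∘ₛ-solve α (prodFin ℓ φ) oneS α₀≉0 (prodFin-≉0 ℓ φ φ₀≉0)

    γ⁻ : Series
    γ⁻ = proj₁ (∘Q-solve γ g₀≉0)

    γ⁻-inverse : γ ⋆ (γ⁻ ∘ₛ Q) ≈ₛ oneS
    γ⁻-inverse = proj₂ (∘Q-solve γ g₀≉0)

    φ⁻ : Fin ℓ → Series
    φ⁻ j = proj₁ (∘Q-solve (φ j) (φ₀≉0 j))

    φ⁻-inverse : ∀ j → φ j ⋆ (φ⁻ j ∘ₛ Q) ≈ₛ oneS
    φ⁻-inverse j = proj₂ (∘Q-solve (φ j) (φ₀≉0 j))

    φ⁻-valid : ∀ j → ValidF (shift (spread (φ⁻ j)))
    φ⁻-valid j = ValidF-shift-spread {φ⁻ j} (*≈1⇒≉0ʳ (∘ₛ-inverse-constantTerm (φ⁻-inverse j)))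

    rightInverse : ∀ {b′} η (θ : Fin ℓ → Series) → A *ᵛ b′ ≈ₛ oneS → γ ⋆ (η ∘ₛ Q) ≈ₛ oneS →
      (∀ j → φ j ⋆ (θ j ∘ₛ Q) ≈ₛ oneS) → (A ⊗ array b′ (spread η) (λ j → shift (spread (θ j)))) ≋ idM
    rightInverse {b′} η θ A*b′≈1 η-inverse θ-inverse = product≋idM A*b′≈1
      (≈ₛ-trans (⋆-congˡ γ (∘ₛ-cong (spread-multiple η) ≈ₛ-refl)) η-inverse)
      (λ j → ≈ₛ-trans (⋆-congˡ (φ j) (∘ₛ-cong (spread-multiple (θ j)) ≈ₛ-refl)) (θ-inverse j))
      where
      θ₀≉0 : ∀ j → θ j 0 ≉ 0#
      θ₀≉0 j = *≈1⇒≉0ʳ (∘ₛ-inverse-constantTerm (θ-inverse j))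
      open Product b g f g∈ f-valid b′ (spread η) (λ j → shift (spread (θ j)))
                   (InTl-spread η) (λ j → ValidF-shift-spread {θ j} (θ₀≉0 j))

module Subgroups {c l} (R : CommutativeRing c l) (isField : IsField R) (ℓ₁ : ℕ) where

  open CommutativeRing R hiding (zero)
  open FieldFacts R isField
  open Spreading R ℓ₁
  open MaR R ℓ
  open FormalPowerSeries R ℓ
  open InfiniteMatrices R ℓ
  open ArrayColumns R ℓ₁
  open Inverses R isField ℓ₁

  IsMaR⇒LowerTriangular : ∀ {M} → IsMaR M → LowerTriangular M
  IsMaR⇒LowerTriangular (b , g , f , _ , g∈ , _ , _ , f-valid , M≋) n<k =
    trans (M≋ _ _) (Array.A-lower b g f g∈ f-valid n<k)

  subgroup-criterion : (S : Matrix → Set (c ⊔ l)) → (∀ M → S M → IsMaR M) → S idM →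
    (∀ M N → S M → S N → S (M ⊗ N)) → (∀ M → S M → Σ Matrix λ N → S N × (M ⊗ N) ≋ idM) → IsSubgroup S
  subgroup-criterion S S⊆MaR idM∈S ⊗-closed hasRightInverse = S⊆MaR , idM∈S , ⊗-closed , inverse
    where
    lower : ∀ {M} → S M → LowerTriangular M
    lower M∈S = IsMaR⇒LowerTriangular (S⊆MaR _ M∈S)

    inverse : ∀ M → S M → Σ Matrix λ N → S N × (M ⊗ N) ≋ idM × (N ⊗ M) ≋ idM
    inverse M M∈S with hasRightInverse M M∈S
    ... | N , N∈S , MN≋I with hasRightInverse N N∈S
    ...   | N′ , _ , NN′≋I = N , N∈S , MN≋I ,
      rightInverse⇒leftInverse M N N′ (lower M∈S) (lower N∈S) MN≋I NN′≋I

  t : Fin ℓ → Series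
  t _ = tS

  t-valid : ∀ j → ValidF (t j)
  t-valid _ = refl , t∈ , 1≉0
    where
    t∈ : ∀ n → ℓ ∤ n → tS (suc n) ≈ 0#
    t∈ zero    ℓ∤0 = contradiction (ℓ ∣0) ℓ∤0
    t∈ (suc n) _   = refl

  decimate-oneS : decimate oneS ≈ₛ oneS
  decimate-oneS zero    = refl
  decimate-oneS (suc m) = refl

  decimate-t : decimate (tS ∘ suc) ≈ₛ oneS
  decimate-t zero    = refl
  decimate-t (suc m) = refl

  shift-spread-oneS : shift (spread oneS) ≈ₛ tS
  shift-spread-oneS = ≈ₛ-trans (shift-cong spread-oneS) shift-oneS

  *-≈1 : ∀ {x y} → x ≈ 1# → y ≈ 1# → x * y ≈ 1#
  *-≈1 x≈1 y≈1 = trans (*-cong x≈1 y≈1) (*-identityˡ 1#)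

  appell : IsSubgroup Appell
  appell = subgroup-criterion Appell Appell⊆MaR idM∈Appell ⊗-closed hasRightInverse
    where
    Appell⊆MaR : ∀ M → Appell M → IsMaR M
    Appell⊆MaR M (b , g , b∈ , g∈ , b₀≈1 , g₀≈1 , M≋) =
      b , g , t , b∈ , g∈ , ≈1⇒≉0 b₀≈1 , ≈1⇒≉0 g₀≈1 , t-valid , M≋

    idM∈Appell : Appell idM
    idM∈Appell = oneS , oneS , oneS∈ , oneS∈ , refl , refl , ≋-sym identity-array

    ⊗-closed : ∀ M N → Appell M → Appell N → Appell (M ⊗ N)
    ⊗-closed M N (b , g , b∈ , g∈ , b₀≈1 , g₀≈1 , M≋) (b′ , g′ , b′∈ , g′∈ , b′₀≈1 , g′₀≈1 , N≋) =
      b″ , g″ , b″∈ b∈ b′∈ , g″∈ , *-≈1 b₀≈1 b′₀≈1 , trans g″₀ (*-≈1 g₀≈1 g′₀≈1) ,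
      ≋-trans (⊗-cong M≋ N≋) (≋-trans product (array-cong ≈ₛ-refl ≈ₛ-refl f″≈t))
      where
      open Product b g t g∈ t-valid b′ g′ t g′∈ t-valid
      f″≈t : ∀ j → f″ j ≈ₛ tS
      f″≈t j = ≈ₛ-trans (⋆-congˡ tS (≈ₛ-trans (∘ₛ-cong decimate-t ≈ₛ-refl) (oneS-∘ₛ M.P))) (⋆-identityʳ tS)

    hasRightInverse : ∀ M → Appell M → Σ Matrix λ N → Appell N × (M ⊗ N) ≋ idM
    hasRightInverse M (b , g , b∈ , g∈ , b₀≈1 , g₀≈1 , M≋) =
      array b⁻ (spread γ⁻) t ,
      (b⁻ , spread γ⁻ , b⁻∈ b∈ , InTl-spread γ⁻ , b⁻₀≈1 b₀≈1 , γ⁻₀≈1 , ≋-refl) ,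
      ≋-trans (⊗-cong M≋ (array-cong ≈ₛ-refl ≈ₛ-refl (λ _ → ≈ₛ-sym shift-spread-oneS)))
        (rightInverse γ⁻ (λ _ → oneS) A*b⁻≈1 γ⁻-inverse φ-inverse)
      where
      open Array b g t g∈ t-valid
      open ArrayInverse b g t g∈ t-valid (≈1⇒≉0 b₀≈1) (≈1⇒≉0 g₀≈1)
      γ⁻₀≈1 : spread γ⁻ 0 ≈ 1#
      γ⁻₀≈1 = trans (spread-multiple γ⁻ 0) (*≈1⇒≈1ʳ g₀≈1 (∘ₛ-inverse-constantTerm γ⁻-inverse))
      φ-inverse : ∀ j → φ j ⋆ (oneS ∘ₛ Q) ≈ₛ oneS
      φ-inverse j = ≈ₛ-trans (⋆-cong decimate-t (oneS-∘ₛ Q)) (⋆-identityˡ oneS)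

  lagrange : IsSubgroup Lagrange
  lagrange = subgroup-criterion Lagrange Lagrange⊆MaR idM∈Lagrange ⊗-closed hasRightInverse
    where
    Lagrange⊆MaR : ∀ M → Lagrange M → IsMaR M
    Lagrange⊆MaR M (f , f-valid , M≋) = oneS , oneS , f , oneS∈ , oneS∈ , 1≉0 , 1≉0 , f-valid , M≋

    idM∈Lagrange : Lagrange idM
    idM∈Lagrange = t , t-valid , ≋-sym identity-array

    ⊗-closed : ∀ M N → Lagrange M → Lagrange N → Lagrange (M ⊗ N)
    ⊗-closed M N (f , f-valid , M≋) (f′ , f′-valid , N≋) =
      f″ , f″-valid , ≋-trans (⊗-cong M≋ N≋) (≋-trans product (array-cong b″≈1 g″≈1 (λ _ → ≈ₛ-refl)))
      where
      open ProductInMaR oneS oneS f oneS∈ f-valid oneS oneS f′ oneS∈ f′-valid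
      b″≈1 : b″ ≈ₛ oneS
      b″≈1 = *ᵛ-oneS M.A
      g″≈1 : g″ ≈ₛ oneS
      g″≈1 = ≈ₛ-trans (⋆-identityˡ _) (≈ₛ-trans (∘ₛ-cong decimate-oneS ≈ₛ-refl) (oneS-∘ₛ M.P))

    hasRightInverse : ∀ M → Lagrange M → Σ Matrix λ N → Lagrange N × (M ⊗ N) ≋ idM
    hasRightInverse M (f , f-valid , M≋) =
      array oneS oneS f⁻ , (f⁻ , φ⁻-valid , ≋-refl) ,
      ≋-trans (⊗-cong M≋ (array-cong ≈ₛ-refl (≈ₛ-sym spread-oneS) (λ _ → ≈ₛ-refl)))
        (rightInverse oneS φ⁻ (*ᵛ-oneS A) γ-inverse φ⁻-inverse)
      where
      open Array oneS oneS f oneS∈ f-valid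
      open ArrayInverse oneS oneS f oneS∈ f-valid 1≉0 1≉0
      f⁻ : Fin ℓ → Series
      f⁻ j = shift (spread (φ⁻ j))
      γ-inverse : γ ⋆ (oneS ∘ₛ Q) ≈ₛ oneS
      γ-inverse = ≈ₛ-trans (⋆-cong decimate-oneS (oneS-∘ₛ Q)) (⋆-identityˡ oneS)

  bell : ∀ j₀ → IsSubgroup (Bell j₀)
  bell j₀ = subgroup-criterion (Bell j₀) Bell⊆MaR idM∈Bell ⊗-closed hasRightInverse
    where
    Bell⊆MaR : ∀ M → Bell j₀ M → IsMaR M
    Bell⊆MaR M (b , g , f , b∈ , g∈ , b₀≈1 , g₀≈1 , f-valid , _ , M≋) =
      b , g , f , b∈ , g∈ , ≈1⇒≉0 b₀≈1 , ≈1⇒≉0 g₀≈1 , f-valid , M≋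

    idM∈Bell : Bell j₀ idM
    idM∈Bell =
      oneS , oneS , t , oneS∈ , oneS∈ , refl , refl , t-valid , ≈ₛ-sym shift-oneS , ≋-sym identity-array

    ⊗-closed : ∀ M N → Bell j₀ M → Bell j₀ N → Bell j₀ (M ⊗ N)
    ⊗-closed M N (b , g , f , b∈ , g∈ , b₀≈1 , g₀≈1 , f-valid , fj₀≈tg , M≋)
                 (b′ , g′ , f′ , b′∈ , g′∈ , b′₀≈1 , g′₀≈1 , f′-valid , f′j₀≈tg′ , N≋) =
      b″ , g″ , f″ , b″∈ b∈ b′∈ , g″∈ , *-≈1 b₀≈1 b′₀≈1 , trans g″₀ (*-≈1 g₀≈1 g′₀≈1) ,
      f″-valid , f″j₀≈tg″ , ≋-trans (⊗-cong M≋ N≋) product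
      where
      open ProductInMaR b g f g∈ f-valid b′ g′ f′ g′∈ f′-valid
      f″j₀≈tg″ : f″ j₀ ≈ₛ shift g″
      f″j₀≈tg″ = ≈ₛ-trans (⋆-cong fj₀≈tg (∘ₛ-cong (λ m → f′j₀≈tg′ (suc (m *ℕ ℓ))) ≈ₛ-refl))
                           (shift-⋆ g (N.γ ∘ₛ M.P))

    hasRightInverse : ∀ M → Bell j₀ M → Σ Matrix λ N → Bell j₀ N × (M ⊗ N) ≋ idM
    hasRightInverse M (b , g , f , b∈ , g∈ , b₀≈1 , g₀≈1 , f-valid , fj₀≈tg , M≋) =
      array b⁻ (spread (φ⁻ j₀)) f⁻ ,
      (b⁻ , spread (φ⁻ j₀) , f⁻ , b⁻∈ b∈ , InTl-spread (φ⁻ j₀) , b⁻₀≈1 b₀≈1 , g⁻₀≈1 , φ⁻-valid ,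
       (λ _ → refl) , ≋-refl) ,
      ≋-trans (⊗-cong M≋ ≋-refl) (rightInverse (φ⁻ j₀) φ⁻ A*b⁻≈1 γ-inverse φ⁻-inverse)
      where
      open Array b g f g∈ f-valid
      open ArrayInverse b g f g∈ f-valid (≈1⇒≉0 b₀≈1) (≈1⇒≉0 g₀≈1)
      f⁻ : Fin ℓ → Series
      f⁻ j = shift (spread (φ⁻ j))
      -- fⱼ₀ = t g forces φⱼ₀ = γ, so the inverse of φⱼ₀ also inverts γ.
      γ-inverse : γ ⋆ (φ⁻ j₀ ∘ₛ Q) ≈ₛ oneS
      γ-inverse = ≈ₛ-trans (⋆-congʳ (φ⁻ j₀ ∘ₛ Q) (λ m → sym (fj₀≈tg (suc (m *ℕ ℓ))))) (φ⁻-inverse j₀)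
      g⁻₀≈1 : spread (φ⁻ j₀) 0 ≈ 1#
      g⁻₀≈1 = trans (spread-multiple (φ⁻ j₀) 0) (*≈1⇒≈1ʳ g₀≈1 (∘ₛ-inverse-constantTerm γ-inverse))

theorem4p1 : ∀ {c l} (R : CommutativeRing c l) → IsField R → CharZero R →
    (ℓ : ℕ) → 2 ≤ ℓ →
    MaR.IsSubgroup R ℓ (MaR.Appell R ℓ)
    × MaR.IsSubgroup R ℓ (MaR.Lagrange R ℓ)
    × ((j : Fin ℓ) → MaR.IsSubgroup R ℓ (MaR.Bell R ℓ j))
theorem4p1 R isField _ (suc ℓ₁) _ = appell , lagrange , bell
  where open Subgroups R isField ℓ₁
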